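{- Let $t\ge 3$, $k_1>k_2\geq k_3\ge\cdots\geq k_t\ge 2$ and $k_1+k_3\leq n<k_1+k_2$. Let $4\leq j\leq k_2+1$ and let $F_2,G_2,H_2\in\mathcal{F}_{2,3}$ with $F_2\setminus F_2^{\mathrm t}=[2,j]$, $G_2\setminus G_2^{\mathrm t}=[2,j-1]$ and $H_2\setminus H_2^{\mathrm t}=[2,j-2]$. If $g(G_2)\geq g(F_2)$, then $g(H_2)>g(G_2)$.
   Context: Lexicographic order: $A\prec B$ if $A\supseteq B$ or $\min(A\setminus B)<\min(B\setminus A)$. $\mathcal{L}(R,k)=\{F\in\binom{[n]}{k}:F\prec R\}$. For $F\subseteq[n]$, $\ell(F)=\max\{x:[n-x+1,n]\subseteq F\}$ if $n\in F$ and $0$ otherwise; $F^{\mathrm t}=[n-\ell(F)+1,n]$ (empty if $\ell(F)=0$). Partner: $H$ is the partner of nonempty $F$ if $F\cap H=\{q\}$ and $F\cup H=[q]$ for some $q$. $k$-partner of $F$ ($|F|=f$, $k\le n-f$), with $H$ the partner of $F$, $h=|H|$: $H$ if $k=h$; $H\cup\{n-k+h+1,\dots,n\}$ if $k>h$; the lexicographically last $k$-set $K\prec H$ if $k<h$. For $h_1\le h_2$: an $h_2$-set $H_2$ is the $h_2$-parity of an $h_1$-set $H_1$ if $H_1\setminus H_1^{\mathrm t}=H_2\setminus H_2^{\mathrm t}$ and $\ell(H_2)-\ell(H_1)=h_2-h_1$. $(A,B)$ is maximal if $\mathcal{L}(A,|A|)$, $\mathcal{L}(B,|B|)$ are cross-intersecting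 and neither can be enlarged (keeping uniformity) while remaining cross-intersecting. $\mathcal{R}_2=\{R\in\binom{[n]}{k_2}:\{1,n-k_2+2,\dots,n\}\prec R\prec\{k_t,n-k_2+2,\dots,n\}\}$, $\mathcal{R}_3=\{R\in\binom{[n]}{k_3}:[k_t]\cup[n-k_3+k_t+1,n]\prec R\prec\{1,n-k_3+2,\dots,n\}\}$, $\mathcal{F}_{2,3}=\{R\in\mathcal{R}_2:\exists R'\in\mathcal{R}_3,\ (R,R')\text{ maximal}\}$. For a $k_2$-set $G_2$ with $k_1$-parity $G_1$ (members of $\mathcal{F}_{2,3}$ have one), with $T_i$ the $k_i$-partner of $G_2$ ($i\in[3,t]$): $g(G_2)=|\mathcal{L}(G_1,k_1)|+|\mathcal{L}(G_2,k_2)|+\sum_{i=3}^t|\mathcal{L}(T_i,k_i)|$. -}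

module Defs where

-- Conventions: a subset of [n] = {1,…,n} is a  Subset n  (Data.Fin.Subset);
-- the index  i : Fin n  stands for the element  suc (toℕ i)  of [n].

open import Data.Nat using (ℕ; zero; suc; _+_; _∸_; _≤_; _<_; _≤ᵇ_)
open import Data.Nat.Properties using (_<?_; _≟_)
open import Data.Bool using (Bool; true; false; _∧_; if_then_else_)
open import Data.Fin using (Fin; toℕ)
open import Data.Fin.Properties using (any?; all?)
open import Data.Fin.Subset using (Subset; _∈_; _∉_; _⊆_; _∩_; _∪_; _─_; ∣_∣; Nonempty; ⁅_⁆)
open import Data.Fin.Subset.Properties using (_∈?_; _⊆?_)
open import Data.Vec using (Vec; []; _∷_; tabulate; toList)
open import Data.List using (List; []; _∷_; _++_; map; filter; length; reverse)
open import Data.Product using (Σ; ∃; ∃-syntax; _×_; _,_)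
open import Data.Sum using (_⊎_)
open import Relation.Nullary using (¬_; Dec)
open import Relation.Nullary.Decidable using (_×-dec_; _⊎-dec_; _→-dec_; ¬?)
open import Relation.Binary.PropositionalEquality using (_≡_)

interval : (n a b : ℕ) → Subset n
interval n a b = tabulate (λ i → (a ≤ᵇ suc (toℕ i)) ∧ (suc (toℕ i) ≤ᵇ b))

-- lexicographic order:  A ≺ B  iff  A ⊇ B  or  min(A∖B) < min(B∖A)
-- (the second alternative: some x ∈ A∖B is smaller than every y ∈ B∖A;
--  when A ⊉ B the set B∖A is nonempty, so this is exactly min(A∖B) < min(B∖A))
_≺_ : {n : ℕ} → Subset n → Subset n → Set
A ≺ B = (B ⊆ A) ⊎ (∃[ x ] (x ∈ A × x ∉ B × (∀ y → y ∈ B → y ∉ A → toℕ x < toℕ y)))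

_≺?_ : {n : ℕ} (A B : Subset n) → Dec (A ≺ B)
A ≺? B = (B ⊆? A) ⊎-dec any? (λ x → (x ∈? A) ×-dec ¬? (x ∈? B) ×-dec
            all? (λ y → (y ∈? B) →-dec ¬? (y ∈? A) →-dec (toℕ x <? toℕ y)))

InL : {n : ℕ} → Subset n → ℕ → Subset n → Set
InL R k F = ∣ F ∣ ≡ k × F ≺ R

allSubsets : (n : ℕ) → List (Subset n)
allSubsets zero = [] ∷ []
allSubsets (suc n) = map (true ∷_) (allSubsets n) ++ map (false ∷_) (allSubsets n)

cardL : {n : ℕ} → Subset n → ℕ → ℕ
cardL R k = length (filter (λ F → (∣ F ∣ ≟ k) ×-dec (F ≺? R)) (allSubsets _))

-- ℓ(F) = max{x : [n-x+1,n] ⊆ F} (= 0 if n ∉ F): the number of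
-- consecutive elements n, n-1, n-2, … lying in F
leadingTrues : List Bool → ℕ
leadingTrues [] = 0
leadingTrues (true ∷ bs) = suc (leadingTrues bs)
leadingTrues (false ∷ bs) = 0

ell : {n : ℕ} → Subset n → ℕ
ell F = leadingTrues (reverse (toList F))

tailSet : {n : ℕ} → Subset n → Subset n
tailSet {n} F = interval n (n ∸ ell F + 1) n

body : {n : ℕ} → Subset n → Subset n
body F = F ─ tailSet F

IsPartner : {n : ℕ} → Subset n → Subset n → Set
IsPartner {n} F H = Nonempty F × ∃[ q ] (F ∩ H ≡ ⁅ q ⁆ × F ∪ H ≡ interval n 1 (suc (toℕ q)))

IsLastBelow : {n : ℕ} → ℕ → Subset n → Subset n → Set
IsLastBelow k H K = ∣ K ∣ ≡ k × K ≺ H × (∀ K′ → ∣ K′ ∣ ≡ k → K′ ≺ H → K′ ≺ K)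

IsKPartner : {n : ℕ} → ℕ → Subset n → Subset n → Set
IsKPartner {n} k F T = ∃[ H ] (IsPartner F H ×
  ((k ≡ ∣ H ∣ → T ≡ H) ×
   (∣ H ∣ < k → T ≡ H ∪ interval n (n ∸ k + ∣ H ∣ + 1) n) ×
   (k < ∣ H ∣ → IsLastBelow k H T)))

IsParity : {n : ℕ} → Subset n → Subset n → Set
IsParity H₁ H₂ = ∣ H₁ ∣ ≤ ∣ H₂ ∣ × body H₁ ≡ body H₂ × ell H₂ ≡ ell H₁ + (∣ H₂ ∣ ∸ ∣ H₁ ∣)

CrossInt : {n : ℕ} → Subset n → Subset n → Set
CrossInt A B = ∀ X Y → InL A ∣ A ∣ X → InL B ∣ B ∣ Y → Nonempty (X ∩ Y)

NotEnlargeable : {n : ℕ} → Subset n → Subset n → Set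
NotEnlargeable A B = ∀ X → ∣ X ∣ ≡ ∣ A ∣ → ¬ InL A ∣ A ∣ X →
  ¬ (∀ Y → InL B ∣ B ∣ Y → Nonempty (X ∩ Y))

Maximal : {n : ℕ} → Subset n → Subset n → Set
Maximal A B = CrossInt A B × NotEnlargeable A B × NotEnlargeable B A

-- the sequence k₁,…,kₜ is given as  k : ℕ → ℕ  (only k 1,…,k t matter)
InR2 : (n t : ℕ) (k : ℕ → ℕ) → Subset n → Set
InR2 n t k R = ∣ R ∣ ≡ k 2
  × (interval n 1 1 ∪ interval n (n ∸ k 2 + 2) n) ≺ R
  × R ≺ (interval n (k t) (k t) ∪ interval n (n ∸ k 2 + 2) n)

InR3 : (n t : ℕ) (k : ℕ → ℕ) → Subset n → Set
InR3 n t k R = ∣ R ∣ ≡ k 3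
  × (interval n 1 (k t) ∪ interval n (n ∸ k 3 + k t + 1) n) ≺ R
  × R ≺ (interval n 1 1 ∪ interval n (n ∸ k 3 + 2) n)

InF23 : (n t : ℕ) (k : ℕ → ℕ) → Subset n → Set
InF23 n t k R = InR2 n t k R × ∃[ R′ ] (InR3 n t k R′ × Maximal R R′)

sumFromTo : ℕ → ℕ → (ℕ → ℕ) → ℕ
sumFromTo a b f = go (suc b ∸ a) a
  where
  go : ℕ → ℕ → ℕ
  go zero i = 0
  go (suc m) i = f i + go m (suc i)

GVal : (n t : ℕ) (k : ℕ → ℕ) → Subset n → ℕ → Set
GVal n t k G₂ v = ∃[ G₁ ] (∣ G₁ ∣ ≡ k 1 × IsParity G₂ G₁ ×
  Σ (ℕ → Subset n) λ T → ((∀ i → 3 ≤ i → i ≤ t → IsKPartner (k i) G₂ (T i)) ×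
          v ≡ cardL G₁ (k 1) + cardL G₂ (k 2) + sumFromTo 3 t (λ i → cardL (T i) (k i))))

-- Let X be a k₂-set with body [2, b+1]. Written as a bit string X = 0 1^b 0^r 1^ℓ; its partner
-- is 1 0^b 1^r 0^(ℓ-1) 1 (or 1 0^(b-1) 1 0^r when ℓ = 0), and each kᵢ-partner Tᵢ is either the last
-- kᵢ-set before it or that partner completed by the last kᵢ-2 elements. Counting lexicographic
-- predecessors of these explicit shapes gives, with N = n-1,
--   g(b) = Σ_{s=1,2} (C(N, k_s-1) + C(N-b, k_s-b)) + Σ_{i=3..t} Σ_{j=1..b} C(N-j, kᵢ-2).
-- By Pascal's rule and symmetry, g(b) - g(b+1) = C(M,c₁) + C(M,c₂) - Σᵢ C(M,eᵢ) with M = N-1-b,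
-- c_s = N-1-k_s and eᵢ = kᵢ-2 ≤ c₁ < c₂. If this difference is ≥ 0 for M, it is > 0 for M+1:
-- with D = M+1-c₁ and the absorption identity (M+1-e) C(M+1,e) = (M+1) C(M,e),
--   D Σᵢ C(M+1,eᵢ) ≤ (M+1) Σᵢ C(M,eᵢ) ≤ (M+1) (C(M,c₁) + C(M,c₂)) < D (C(M+1,c₁) + C(M+1,c₂)),
-- the last step because M+1-c₂ < D. Taking b = j-1, j-2, j-3 gives the lemma.

module Submission where

open import Defs
open import Data.Bool using (Bool; true; false; _∧_; _∨_; not; if_then_else_; T)
open import Data.Bool.Properties using (∧-zeroʳ; ∧-identityʳ; ∨-zeroʳ; ∨-identityʳ)
open import Data.Empty using (⊥-elim)
open import Data.Fin using (Fin; toℕ) renaming (zero to fzero; suc to fsuc)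
open import Data.Fin.Subset using (Subset; _∈_; _∉_; ∣_∣; _∪_; _∩_; _─_; ⁅_⁆)
open import Data.Fin.Properties using (toℕ<n)
open import Data.List using (List; []; _∷_; _++_; [_]; map; filter; length; reverse)
open import Data.List.Properties using (filter-++; filter-≐; length-++; length-reverse; unfold-reverse)
open import Data.Nat using (ℕ; zero; suc; _+_; _*_; _∸_; _≤_; _<_; _>_; z≤n; s≤s; _<ᵇ_; _≤ᵇ_; _≡ᵇ_; >-nonZero; _≤′_; ≤′-refl; ≤′-step)
open import Data.Nat.Combinatorics using (_C_; nCk+nC[k+1]≡[n+1]C[k+1]; nCn≡1; nC1≡n; k>n⇒nCk≡0; nCk≡nC[n∸k])
open import Data.Nat.Properties
open import Data.Nat.Tactic.RingSolver using (solve-∀)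
open import Data.Product using (_×_; _,_; proj₁; proj₂)
open import Data.Sum using (inj₁; inj₂)
open import Data.Vec using ([]; _∷_; here; there; tabulate; toList)
open import Data.Vec.Properties using (length-toList; tabulate-cong)
open import Function using (_∘_)
open import Level using (0ℓ)
open import Relation.Nullary using (¬_; yes; no)
open import Relation.Nullary.Reflects using (Reflects; ofʸ; ofⁿ; det; fromEquivalence)
open import Relation.Nullary.Decidable using (_×-dec_)
open import Relation.Unary using (Pred; Decidable)
open import Relation.Binary.PropositionalEquality
  using (_≡_; _≢_; refl; sym; trans; cong; cong₂; subst; subst₂; module ≡-Reasoning)

true∷≺false∷ : ∀ {n} {A B : Subset n} → (true ∷ A) ≺ (false ∷ B)
true∷≺false∷ = inj₂ (fzero , here , (λ ()) , λ { (fsuc _) _ _ → s≤s z≤n })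

false∷⊀true∷ : ∀ {n} {A B : Subset n} → ¬ ((false ∷ A) ≺ (true ∷ B))
false∷⊀true∷ (inj₁ B⊆A) with B⊆A here
... | ()
false∷⊀true∷ (inj₂ (_ , _ , _ , below)) with below fzero here (λ ())
... | ()

∈-tail : ∀ {n c} {A : Subset n} {x : Fin n} → fsuc x ∈ (c ∷ A) → x ∈ A
∈-tail (there x∈A) = x∈A

∷-≺⁻ : ∀ {n c} {A B : Subset n} → (c ∷ A) ≺ (c ∷ B) → A ≺ B
∷-≺⁻ (inj₁ B⊆A) = inj₁ (λ x∈B → ∈-tail (B⊆A (there x∈B)))
∷-≺⁻ {c = true} (inj₂ (fzero , _ , x∉B , _)) = ⊥-elim (x∉B here)
∷-≺⁻ {c = false} (inj₂ (fzero , () , _ , _))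
∷-≺⁻ (inj₂ (fsuc x , there x∈A , x∉B , below)) =
  inj₂ (x , x∈A , (λ x∈B → x∉B (there x∈B)) ,
        λ y y∈B y∉A → ≤-pred (below (fsuc y) (there y∈B) (λ y∈A → y∉A (∈-tail y∈A))))

∷-≺⁺ : ∀ {n c} {A B : Subset n} → A ≺ B → (c ∷ A) ≺ (c ∷ B)
∷-≺⁺ (inj₁ B⊆A) = inj₁ λ { here → here ; (there x∈B) → there (B⊆A x∈B) }
∷-≺⁺ {c = c} {A} {B} (inj₂ (x , x∈A , x∉B , below)) =
  inj₂ (fsuc x , there x∈A , (λ x∈B → x∉B (∈-tail x∈B)) , below′)
  where
  below′ : ∀ y → y ∈ (c ∷ B) → y ∉ (c ∷ A) → suc (toℕ x) < toℕ y
  below′ fzero here y∉A = ⊥-elim (y∉A here)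
  below′ (fsuc y) (there y∈B) y∉A = s≤s (below y y∈B (λ y∈A → y∉A (there y∈A)))

≺-trans : ∀ {n} {A B D : Subset n} → A ≺ B → B ≺ D → A ≺ D
≺-trans {A = []} {[]} {[]} _ _ = inj₁ λ ()
≺-trans {A = true ∷ A} {true ∷ B} {true ∷ D} p q = ∷-≺⁺ (≺-trans (∷-≺⁻ p) (∷-≺⁻ q))
≺-trans {A = true ∷ A} {true ∷ B} {false ∷ D} p q = true∷≺false∷
≺-trans {A = true ∷ A} {false ∷ B} {false ∷ D} p q = true∷≺false∷
≺-trans {A = false ∷ A} {false ∷ B} {false ∷ D} p q = ∷-≺⁺ (≺-trans (∷-≺⁻ p) (∷-≺⁻ q))
≺-trans {A = false ∷ A} {true ∷ B} p q = ⊥-elim (false∷⊀true∷ p)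
≺-trans {B = false ∷ B} {true ∷ D} p q = ⊥-elim (false∷⊀true∷ q)

-- Counting 𝓛(R,k)

module _ {A : Set} where

  count : {P : Pred A 0ℓ} → Decidable P → List A → ℕ
  count P? xs = length (filter P? xs)

  count-≐ : {P Q : Pred A 0ℓ} (P? : Decidable P) (Q? : Decidable Q) →
            (∀ {x} → P x → Q x) → (∀ {x} → Q x → P x) → ∀ xs → count P? xs ≡ count Q? xs
  count-≐ P? Q? P⇒Q Q⇒P xs = cong length (filter-≐ P? Q? (P⇒Q , Q⇒P) xs)

  count-none : {P : Pred A 0ℓ} (P? : Decidable P) → (∀ {x} → ¬ P x) → ∀ xs → count P? xs ≡ 0
  count-none P? ¬P [] = refl
  count-none P? ¬P (x ∷ xs) with P? x
  ... | yes Px = ⊥-elim (¬P Px)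
  ... | no _ = count-none P? ¬P xs

  count-++ : {P : Pred A 0ℓ} (P? : Decidable P) → ∀ xs ys → count P? (xs ++ ys) ≡ count P? xs + count P? ys
  count-++ P? xs ys = trans (cong length (filter-++ P? xs ys)) (length-++ (filter P? xs))

count-map : ∀ {A B : Set} {P : Pred B 0ℓ} (P? : Decidable P) (f : A → B) →
            ∀ xs → count P? (map f xs) ≡ count (P? ∘ f) xs
count-map P? f [] = refl
count-map P? f (x ∷ xs) with P? (f x)
... | yes _ = cong suc (count-map P? f xs)
... | no _ = count-map P? f xs

count-allSubsets-suc : ∀ {n} {P : Pred (Subset (suc n)) 0ℓ} (P? : Decidable P) →
  count P? (allSubsets (suc n)) ≡ count (P? ∘ (true ∷_)) (allSubsets n) + count (P? ∘ (false ∷_)) (allSubsets n)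
count-allSubsets-suc {n} P? = trans (count-++ P? (map (true ∷_) (allSubsets n)) _)
  (cong₂ _+_ (count-map P? (true ∷_) (allSubsets n)) (count-map P? (false ∷_) (allSubsets n)))

hasSize? : ∀ {n} k → Decidable (λ (F : Subset n) → ∣ F ∣ ≡ k)
hasSize? k F = ∣ F ∣ ≟ k

count-hasSize : ∀ n k → count (hasSize? k) (allSubsets n) ≡ n C k
count-hasSize zero zero = refl
count-hasSize zero (suc k) = refl
count-hasSize (suc n) zero = trans (count-allSubsets-suc {n} (hasSize? 0))
  (cong₂ _+_ (count-none _ (λ ()) (allSubsets n)) (count-hasSize n zero))
count-hasSize (suc n) (suc k) = begin
  count (hasSize? (suc k)) (allSubsets (suc n))
    ≡⟨ count-allSubsets-suc {n} (hasSize? (suc k)) ⟩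
  count (hasSize? (suc k) ∘ (true ∷_)) (allSubsets n) + count (hasSize? (suc k)) (allSubsets n)
    ≡⟨ cong₂ _+_ (count-≐ _ (hasSize? k) suc-injective (cong suc) (allSubsets n)) (count-hasSize n (suc k)) ⟩
  count (hasSize? k) (allSubsets n) + n C suc k
    ≡⟨ cong (_+ n C suc k) (count-hasSize n k) ⟩
  n C k + n C suc k
    ≡⟨ nCk+nC[k+1]≡[n+1]C[k+1] n k ⟩
  suc n C suc k ∎
  where open ≡-Reasoning

-- If R starts with 0, each of the n C k sets of size k+1 starting with 1 precedes R.
lexCount : ∀ {n} → ℕ → Subset n → ℕ
lexCount {zero} zero [] = 1
lexCount {zero} (suc k) [] = 0
lexCount zero (true ∷ R) = 0
lexCount (suc k) (true ∷ R) = lexCount k R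
lexCount zero (false ∷ R) = lexCount zero R
lexCount {suc n} (suc k) (false ∷ R) = n C k + lexCount (suc k) R

inL? : ∀ {n} k (R : Subset n) → Decidable (InL R k)
inL? k R F = (∣ F ∣ ≟ k) ×-dec (F ≺? R)

cardL≡lexCount : ∀ {n} (R : Subset n) k → cardL R k ≡ lexCount k R
cardL≡lexCount {zero} [] zero with inL? zero [] []
... | yes _ = refl
... | no ∉L = ⊥-elim (∉L (refl , inj₁ λ ()))
cardL≡lexCount {zero} [] (suc k) with inL? (suc k) [] []
... | yes (() , _)
... | no _ = refl
cardL≡lexCount {suc n} (true ∷ R) zero = trans (count-allSubsets-suc {n} (inL? zero (true ∷ R)))
  (cong₂ _+_ (count-none _ (λ ()) (allSubsets n)) (count-none _ (false∷⊀true∷ ∘ proj₂) (allSubsets n)))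
cardL≡lexCount {suc n} (true ∷ R) (suc k) = begin
  cardL (true ∷ R) (suc k)
    ≡⟨ count-allSubsets-suc {n} (inL? (suc k) (true ∷ R)) ⟩
  count (inL? (suc k) (true ∷ R) ∘ (true ∷_)) (allSubsets n) + count (inL? (suc k) (true ∷ R) ∘ (false ∷_)) (allSubsets n)
    ≡⟨ cong₂ _+_ (count-≐ _ (inL? k R) (λ (s , p) → suc-injective s , ∷-≺⁻ p) (λ (s , p) → cong suc s , ∷-≺⁺ p) (allSubsets n))
                 (count-none _ (false∷⊀true∷ ∘ proj₂) (allSubsets n)) ⟩
  cardL R k + 0
    ≡⟨ +-identityʳ _ ⟩
  cardL R k
    ≡⟨ cardL≡lexCount R k ⟩
  lexCount k R ∎
  where open ≡-Reasoning
cardL≡lexCount {suc n} (false ∷ R) zero = trans (count-allSubsets-suc {n} (inL? zero (false ∷ R)))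
  (cong₂ _+_ (count-none _ (λ ()) (allSubsets n))
    (trans (count-≐ _ (inL? zero R) (λ (s , p) → s , ∷-≺⁻ p) (λ (s , p) → s , ∷-≺⁺ p) (allSubsets n)) (cardL≡lexCount R zero)))
cardL≡lexCount {suc n} (false ∷ R) (suc k) = trans (count-allSubsets-suc {n} (inL? (suc k) (false ∷ R)))
  (cong₂ _+_
    (trans (count-≐ _ (hasSize? k) (suc-injective ∘ proj₁) (λ s → cong suc s , true∷≺false∷) (allSubsets n)) (count-hasSize n k))
    (trans (count-≐ _ (inL? (suc k) R) (λ (s , p) → s , ∷-≺⁻ p) (λ (s , p) → s , ∷-≺⁺ p) (allSubsets n)) (cardL≡lexCount R (suc k))))

cardL-lastBelow : ∀ {n k} {H T : Subset n} → IsLastBelow k H T → cardL T k ≡ cardL H k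
cardL-lastBelow {n} {k} {H} {T} (_ , T≺H , last) =
  count-≐ (inL? k T) (inL? k H) (λ (s , F≺T) → s , ≺-trans F≺T T≺H) (λ (s , F≺H) → s , last _ s F≺H) (allSubsets n)

-- Subsets as bit functions on positions 0,…,n-1 (position x stands for x+1 ∈ [n])

reflects-true : ∀ {P : Set} {b} → Reflects P b → P → b ≡ true
reflects-true r p = det r (ofʸ p)

reflects-false : ∀ {P : Set} {b} → Reflects P b → ¬ P → b ≡ false
reflects-false r ¬p = det r (ofⁿ ¬p)

<ᵇ-true : ∀ {m n} → m < n → (m <ᵇ n) ≡ true
<ᵇ-true {m} {n} = reflects-true (<ᵇ-reflects-< m n)

<ᵇ-false : ∀ {m n} → n ≤ m → (m <ᵇ n) ≡ false
<ᵇ-false {m} {n} n≤m = reflects-false (<ᵇ-reflects-< m n) (≤⇒≯ n≤m)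

≤ᵇ-true : ∀ {m n} → m ≤ n → (m ≤ᵇ n) ≡ true
≤ᵇ-true {m} {n} = reflects-true (≤ᵇ-reflects-≤ m n)

≤ᵇ-false : ∀ {m n} → n < m → (m ≤ᵇ n) ≡ false
≤ᵇ-false {m} {n} n<m = reflects-false (≤ᵇ-reflects-≤ m n) (<⇒≱ n<m)

≡ᵇ-reflects-≡ : ∀ m n → Reflects (m ≡ n) (m ≡ᵇ n)
≡ᵇ-reflects-≡ m n = fromEquivalence (≡ᵇ⇒≡ m n) (≡⇒≡ᵇ m n)

≡ᵇ-true : ∀ m → (m ≡ᵇ m) ≡ true
≡ᵇ-true m = reflects-true (≡ᵇ-reflects-≡ m m) refl

≡ᵇ-false : ∀ {m n} → m ≢ n → (m ≡ᵇ n) ≡ false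
≡ᵇ-false {m} {n} = reflects-false (≡ᵇ-reflects-≡ m n)

bit : ∀ {n} → Subset n → ℕ → Bool
bit [] x = false
bit (b ∷ A) zero = b
bit (b ∷ A) (suc x) = bit A x

fromBits : (n : ℕ) → (ℕ → Bool) → Subset n
fromBits n p = tabulate (p ∘ toℕ)

bit-fromBits : ∀ n (p : ℕ → Bool) {x} → x < n → bit (fromBits n p) x ≡ p x
bit-fromBits (suc n) p {zero} _ = refl
bit-fromBits (suc n) p {suc x} (s≤s x<n) = bit-fromBits n (p ∘ suc) x<n

bit-ext : ∀ {n} {A B : Subset n} → (∀ {x} → x < n → bit A x ≡ bit B x) → A ≡ B
bit-ext {A = []} {[]} _ = refl
bit-ext {A = a ∷ A} {b ∷ B} eq = cong₂ _∷_ (eq (s≤s z≤n)) (bit-ext (eq ∘ s≤s))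

≡-fromBits : ∀ {n} {A : Subset n} {p} → (∀ {x} → x < n → bit A x ≡ p x) → A ≡ fromBits n p
≡-fromBits {n} {p = p} eq = bit-ext λ x<n → trans (eq x<n) (sym (bit-fromBits n p x<n))

bit-∪ : ∀ {n} (A B : Subset n) x → bit (A ∪ B) x ≡ (bit A x ∨ bit B x)
bit-∪ [] [] x = refl
bit-∪ (a ∷ A) (b ∷ B) zero = refl
bit-∪ (a ∷ A) (b ∷ B) (suc x) = bit-∪ A B x

bit-∩ : ∀ {n} (A B : Subset n) x → bit (A ∩ B) x ≡ (bit A x ∧ bit B x)
bit-∩ [] [] x = refl
bit-∩ (a ∷ A) (b ∷ B) zero = refl
bit-∩ (a ∷ A) (b ∷ B) (suc x) = bit-∩ A B x

bit-─ : ∀ {n} (A B : Subset n) x → bit (A ─ B) x ≡ (bit A x ∧ not (bit B x))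
bit-─ [] [] x = refl
bit-─ (true ∷ A) (true ∷ B) zero = refl
bit-─ (true ∷ A) (false ∷ B) zero = refl
bit-─ (false ∷ A) (true ∷ B) zero = refl
bit-─ (false ∷ A) (false ∷ B) zero = refl
bit-─ (a ∷ A) (b ∷ B) (suc x) = bit-─ A B x

bit-interval : ∀ n a b {x} → x < n → bit (interval n a b) x ≡ ((a ≤ᵇ suc x) ∧ (suc x ≤ᵇ b))
bit-interval n a b = bit-fromBits n (λ x → (a ≤ᵇ suc x) ∧ (suc x ≤ᵇ b))

bit-⁅⁆ : ∀ {n} (q : Fin n) x → bit ⁅ q ⁆ x ≡ (toℕ q ≡ᵇ x)
bit-⁅⁆ fzero zero = refl
bit-⁅⁆ {suc n} fzero (suc x) = bit-empty n x
  where
  bit-empty : ∀ n x → bit (Data.Fin.Subset.⊥ {n}) x ≡ false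
  bit-empty zero x = refl
  bit-empty (suc n) zero = refl
  bit-empty (suc n) (suc x) = bit-empty n x
bit-⁅⁆ (fsuc q) zero = refl
bit-⁅⁆ (fsuc q) (suc x) = bit-⁅⁆ q x

fromBits-cong : ∀ n {p q : ℕ → Bool} → (∀ {x} → x < n → p x ≡ q x) → fromBits n p ≡ fromBits n q
fromBits-cong n eq = tabulate-cong (λ i → eq (toℕ<n i))

bit-finalInterval : ∀ n u {x} → x < n → bit (interval n (u + 1) n) x ≡ (u ≤ᵇ x)
bit-finalInterval n u {x} x<n = trans (bit-interval n (u + 1) n x<n)
  (trans (cong ((u + 1 ≤ᵇ suc x) ∧_) (≤ᵇ-true x<n)) (trans (∧-identityʳ _) shift))
  where
  shift : (u + 1 ≤ᵇ suc x) ≡ (u ≤ᵇ x)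
  shift with u ≤? x
  ... | yes u≤x = trans (≤ᵇ-true (subst (_≤ suc x) (+-comm 1 u) (s≤s u≤x))) (sym (≤ᵇ-true u≤x))
  ... | no u≰x = trans (≤ᵇ-false (subst (suc x <_) (+-comm 1 u) (s≤s (≰⇒> u≰x)))) (sym (≤ᵇ-false (≰⇒> u≰x)))

bitList : List Bool → ℕ → Bool
bitList [] x = false
bitList (b ∷ bs) zero = b
bitList (b ∷ bs) (suc x) = bitList bs x

bit≡bitList : ∀ {n} (F : Subset n) x → bit F x ≡ bitList (toList F) x
bit≡bitList [] x = refl
bit≡bitList (b ∷ F) zero = refl
bit≡bitList (b ∷ F) (suc x) = bit≡bitList F x

bitList-++ˡ : ∀ xs ys {i} → i < length xs → bitList (xs ++ ys) i ≡ bitList xs i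
bitList-++ˡ (x ∷ xs) ys {zero} _ = refl
bitList-++ˡ (x ∷ xs) ys {suc i} (s≤s i<) = bitList-++ˡ xs ys i<

bitList-++ʳ : ∀ xs ys i → bitList (xs ++ ys) (length xs + i) ≡ bitList ys i
bitList-++ʳ [] ys i = refl
bitList-++ʳ (x ∷ xs) ys i = bitList-++ʳ xs ys i

bitList-reverse : ∀ xs {i} → i < length xs → bitList (reverse xs) i ≡ bitList xs (length xs ∸ suc i)
bitList-reverse (x ∷ xs) {i} (s≤s i≤) rewrite unfold-reverse x xs with m≤n⇒m<n∨m≡n i≤
... | inj₁ i<xs = begin
  bitList (reverse xs ++ [ x ]) i          ≡⟨ bitList-++ˡ (reverse xs) [ x ] (subst (i <_) (sym (length-reverse xs)) i<xs) ⟩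
  bitList (reverse xs) i                   ≡⟨ bitList-reverse xs i<xs ⟩
  bitList xs (length xs ∸ suc i)           ≡⟨ cong (bitList (x ∷ xs)) (sym (+-∸-assoc 1 i<xs)) ⟩
  bitList (x ∷ xs) (length xs ∸ i)         ∎
  where open ≡-Reasoning
... | inj₂ refl = begin
  bitList (reverse xs ++ [ x ]) (length xs)              ≡⟨ cong (bitList (reverse xs ++ [ x ])) (sym (+-identityʳ (length xs))) ⟩
  bitList (reverse xs ++ [ x ]) (length xs + 0)          ≡⟨ cong (λ m → bitList (reverse xs ++ [ x ]) (m + 0)) (sym (length-reverse xs)) ⟩
  bitList (reverse xs ++ [ x ]) (length (reverse xs) + 0) ≡⟨ bitList-++ʳ (reverse xs) [ x ] 0 ⟩
  x                                                     ≡⟨ cong (bitList (x ∷ xs)) (sym (n∸n≡0 (length xs))) ⟩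
  bitList (x ∷ xs) (length xs ∸ length xs)               ∎
  where open ≡-Reasoning

bitList-leadingTrues : ∀ bs {i} → i < leadingTrues bs → bitList bs i ≡ true
bitList-leadingTrues (true ∷ bs) {zero} _ = refl
bitList-leadingTrues (true ∷ bs) {suc i} (s≤s i<) = bitList-leadingTrues bs i<

leadingTrues≤length : ∀ bs → leadingTrues bs ≤ length bs
leadingTrues≤length [] = z≤n
leadingTrues≤length (true ∷ bs) = s≤s (leadingTrues≤length bs)
leadingTrues≤length (false ∷ bs) = z≤n

ell≤n : ∀ {n} (F : Subset n) → ell F ≤ n
ell≤n F = subst (ell F ≤_) (trans (length-reverse (toList F)) (length-toList F))
                 (leadingTrues≤length (reverse (toList F)))

bit-tail : ∀ {n} (F : Subset n) {x} → x < n → n ∸ ell F ≤ x → bit F x ≡ true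
bit-tail {suc n} F {x} (s≤s x≤n) tail≤x = begin
  bit F x                                        ≡⟨ bit≡bitList F x ⟩
  bitList (toList F) x                           ≡⟨ cong (bitList (toList F)) (sym (m∸[m∸n]≡n x≤n)) ⟩
  bitList (toList F) (suc n ∸ suc (n ∸ x))       ≡⟨ cong (λ m → bitList (toList F) (m ∸ suc (n ∸ x))) (sym (length-toList F)) ⟩
  bitList (toList F) (length (toList F) ∸ suc (n ∸ x)) ≡⟨ sym (bitList-reverse (toList F) i<length) ⟩
  bitList (reverse (toList F)) (n ∸ x)           ≡⟨ bitList-leadingTrues (reverse (toList F)) i<ell ⟩
  true                                           ∎
  where
  open ≡-Reasoning
  i<ell : n ∸ x < ell F
  i<ell = subst (_≤ ell F) (+-∸-assoc 1 x≤n) (m≤n+o⇒m∸n≤o (suc n) x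
            (subst (_≤ x + ell F) (m∸n+n≡m (ell≤n F)) (+-monoˡ-≤ (ell F) tail≤x)))
  i<length : n ∸ x < length (toList F)
  i<length = subst (n ∸ x <_) (sym (length-toList F)) (s≤s (m∸n≤m n x))

bit-tailSet : ∀ {n} (F : Subset n) {x} → x < n → bit (tailSet F) x ≡ (n ∸ ell F ≤ᵇ x)
bit-tailSet {n} F = bit-finalInterval n (n ∸ ell F)

-- Subsets given by runs of equal bits: (c , m) is a run of m copies of c

data Offset (m : ℕ) : ℕ → Set where
  before : ∀ {x} → x < m → Offset m x
  after : ∀ y → Offset m (m + y)

offset : ∀ m x → Offset m x
offset zero x = after x
offset (suc m) zero = before (s≤s z≤n)
offset (suc m) (suc x) with offset m x
... | before x<m = before (s≤s x<m)
... | after y = after y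

Blocks : Set
Blocks = List (Bool × ℕ)

blocksBit : Blocks → ℕ → Bool
blocksBit [] x = false
blocksBit ((c , m) ∷ bs) x = if x <ᵇ m then c else blocksBit bs (x ∸ m)

blocksLength : Blocks → ℕ
blocksLength [] = 0
blocksLength ((_ , m) ∷ bs) = m + blocksLength bs

blocksSize : Blocks → ℕ
blocksSize [] = 0
blocksSize ((true , m) ∷ bs) = m + blocksSize bs
blocksSize ((false , m) ∷ bs) = blocksSize bs

fromBlocks : (n : ℕ) → Blocks → Subset n
fromBlocks n bs = fromBits n (blocksBit bs)

flipBlocks : Blocks → Blocks
flipBlocks = map λ (c , m) → (not c , m)

blocksBit-here : ∀ c m bs {x} → x < m → blocksBit ((c , m) ∷ bs) x ≡ c
blocksBit-here c m bs x<m rewrite <ᵇ-true x<m = refl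

blocksBit-skip : ∀ c m bs y → blocksBit ((c , m) ∷ bs) (m + y) ≡ blocksBit bs y
blocksBit-skip c m bs y rewrite <ᵇ-false {m + y} {m} (m≤m+n m y) | m+n∸m≡n m y = refl

blocksBit-empty : ∀ c bs x → blocksBit ((c , 0) ∷ bs) x ≡ blocksBit bs x
blocksBit-empty c bs x = blocksBit-skip c 0 bs x

blocksBit-merge : ∀ c m m′ bs x → blocksBit ((c , m) ∷ (c , m′) ∷ bs) x ≡ blocksBit ((c , m + m′) ∷ bs) x
blocksBit-merge c m m′ bs x with offset m x
... | before x<m = trans (blocksBit-here c m ((c , m′) ∷ bs) x<m) (sym (blocksBit-here c (m + m′) bs (≤-trans x<m (m≤m+n m m′))))
... | after y with offset m′ y
...   | before y<m′ = trans (blocksBit-skip c m ((c , m′) ∷ bs) y)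
          (trans (blocksBit-here c m′ bs y<m′) (sym (blocksBit-here c (m + m′) bs (+-monoʳ-< m y<m′))))
...   | after z = begin
  blocksBit ((c , m) ∷ (c , m′) ∷ bs) (m + (m′ + z)) ≡⟨ blocksBit-skip c m ((c , m′) ∷ bs) (m′ + z) ⟩
  blocksBit ((c , m′) ∷ bs) (m′ + z)                 ≡⟨ blocksBit-skip c m′ bs z ⟩
  blocksBit bs z                                     ≡⟨ sym (blocksBit-skip c (m + m′) bs z) ⟩
  blocksBit ((c , m + m′) ∷ bs) (m + m′ + z)         ≡⟨ cong (blocksBit ((c , m + m′) ∷ bs)) (+-assoc m m′ z) ⟩
  blocksBit ((c , m + m′) ∷ bs) (m + (m′ + z))       ∎
  where open ≡-Reasoning

blocksBit-++ˡ : ∀ bs cs {x} → x < blocksLength bs → blocksBit (bs ++ cs) x ≡ blocksBit bs x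
blocksBit-++ˡ ((c , m) ∷ bs) cs {x} x< with offset m x
... | before x<m = trans (blocksBit-here c m (bs ++ cs) x<m) (sym (blocksBit-here c m bs x<m))
... | after y = trans (blocksBit-skip c m (bs ++ cs) y)
      (trans (blocksBit-++ˡ bs cs (+-cancelˡ-< m y (blocksLength bs) x<)) (sym (blocksBit-skip c m bs y)))

blocksBit-++ʳ : ∀ bs cs y → blocksBit (bs ++ cs) (blocksLength bs + y) ≡ blocksBit cs y
blocksBit-++ʳ [] cs y = refl
blocksBit-++ʳ ((c , m) ∷ bs) cs y = trans (cong (blocksBit ((c , m) ∷ bs ++ cs)) (+-assoc m (blocksLength bs) y))
  (trans (blocksBit-skip c m (bs ++ cs) (blocksLength bs + y)) (blocksBit-++ʳ bs cs y))

blocksBit-++-cong : ∀ ds bs cs → (∀ x → blocksBit bs x ≡ blocksBit cs x) →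
                    ∀ x → blocksBit (ds ++ bs) x ≡ blocksBit (ds ++ cs) x
blocksBit-++-cong [] bs cs eq x = eq x
blocksBit-++-cong ((c , m) ∷ ds) bs cs eq x with x <ᵇ m
... | true = refl
... | false = blocksBit-++-cong ds bs cs eq (x ∸ m)

blocksBit-flip : ∀ bs {x} → x < blocksLength bs → blocksBit (flipBlocks bs) x ≡ not (blocksBit bs x)
blocksBit-flip ((c , m) ∷ bs) {x} x< with offset m x
... | before x<m = trans (blocksBit-here (not c) m (flipBlocks bs) x<m) (cong not (sym (blocksBit-here c m bs x<m)))
... | after y = trans (blocksBit-skip (not c) m (flipBlocks bs) y)
      (trans (blocksBit-flip bs (+-cancelˡ-< m y (blocksLength bs) x<)) (cong not (sym (blocksBit-skip c m bs y))))

blocksBit-noTail : ∀ r x → blocksBit ((false , r) ∷ (true , 0) ∷ []) x ≡ false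
blocksBit-noTail r x with x <ᵇ r
... | true = refl
... | false = blocksBit-empty true [] (x ∸ r)

blocksBit-splitRun : ∀ c m bs x → blocksBit ((c , suc m) ∷ bs) x ≡ blocksBit ((c , m) ∷ (c , 1) ∷ bs) x
blocksBit-splitRun c m bs x = trans (cong (λ k → blocksBit ((c , k) ∷ bs) x) (+-comm 1 m)) (sym (blocksBit-merge c m 1 bs x))

fromBlocks-cong : ∀ n bs cs → (∀ x → blocksBit bs x ≡ blocksBit cs x) → fromBlocks n bs ≡ fromBlocks n cs
fromBlocks-cong n bs cs eq = fromBits-cong n λ {x} _ → eq x

fromBlocks-empty : ∀ n c bs → fromBlocks n ((c , 0) ∷ bs) ≡ fromBlocks n bs
fromBlocks-empty n c bs = fromBits-cong n λ {x} _ → blocksBit-empty c bs x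

size-fromBlocks : ∀ {n} bs → n ≡ blocksLength bs → ∣ fromBlocks n bs ∣ ≡ blocksSize bs
size-fromBlocks [] refl = refl
size-fromBlocks ((c , m) ∷ bs) refl = go c m
  where
  go : ∀ c m → ∣ fromBlocks (m + blocksLength bs) ((c , m) ∷ bs) ∣ ≡ blocksSize ((c , m) ∷ bs)
  go true zero = trans (cong ∣_∣ (fromBlocks-empty (blocksLength bs) true bs)) (size-fromBlocks bs refl)
  go false zero = trans (cong ∣_∣ (fromBlocks-empty (blocksLength bs) false bs)) (size-fromBlocks bs refl)
  go true (suc m) = cong suc (go true m)
  go false (suc m) = go false m

blocksLength-flip : ∀ bs → blocksLength (flipBlocks bs) ≡ blocksLength bs
blocksLength-flip [] = refl
blocksLength-flip ((c , m) ∷ bs) = cong (m +_) (blocksLength-flip bs)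

bodyTailBlocks : ℕ → ℕ → ℕ → Blocks
bodyTailBlocks b r ℓ = (false , 1) ∷ (true , b) ∷ (false , r) ∷ (true , ℓ) ∷ []

module _ {n} (F : Subset n) {b} (1≤b : 1 ≤ b) (b<n : b < n) (body≡ : body F ≡ interval n 2 (suc b)) where

  private
    u = n ∸ ell F

    bit-outsideTail : ∀ {x} → x < n → x < u → bit F x ≡ ((2 ≤ᵇ suc x) ∧ (suc x ≤ᵇ suc b))
    bit-outsideTail {x} x<n x<u = begin
      bit F x                                  ≡⟨ sym (∧-identityʳ (bit F x)) ⟩
      bit F x ∧ not false                      ≡⟨ cong (λ c → bit F x ∧ not c) (sym (trans (bit-tailSet F x<n) (≤ᵇ-false x<u))) ⟩
      bit F x ∧ not (bit (tailSet F) x)        ≡⟨ sym (bit-─ F (tailSet F) x) ⟩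
      bit (body F) x                           ≡⟨ cong (λ A → bit A x) body≡ ⟩
      bit (interval n 2 (suc b)) x             ≡⟨ bit-interval n 2 (suc b) x<n ⟩
      (2 ≤ᵇ suc x) ∧ (suc x ≤ᵇ suc b)          ∎
      where open ≡-Reasoning

    b<u : b < u
    b<u with b <? u
    ... | yes b<u = b<u
    ... | no b≮u = contradiction′ (begin
      true                                     ≡⟨ sym (cong₂ _∧_ (≤ᵇ-true (s≤s 1≤b)) (≤ᵇ-true (≤-refl {suc b}))) ⟩
      (2 ≤ᵇ suc b) ∧ (suc b ≤ᵇ suc b)          ≡⟨ sym (bit-interval n 2 (suc b) b<n) ⟩
      bit (interval n 2 (suc b)) b             ≡⟨ cong (λ A → bit A b) (sym body≡) ⟩
      bit (body F) b                           ≡⟨ bit-─ F (tailSet F) b ⟩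
      bit F b ∧ not (bit (tailSet F) b)        ≡⟨ cong (λ c → bit F b ∧ not c) (trans (bit-tailSet F b<n) (≤ᵇ-true (≮⇒≥ b≮u))) ⟩
      bit F b ∧ false                          ≡⟨ ∧-zeroʳ (bit F b) ⟩
      false                                    ∎)
      where
      open ≡-Reasoning
      contradiction′ : true ≡ false → b < u
      contradiction′ ()

  gapLength : ℕ
  gapLength = u ∸ suc b

  private
    u≡ : u ≡ suc (b + gapLength)
    u≡ = sym (m+[n∸m]≡n b<u)

  length-bodyTailBlocks : n ≡ blocksLength (bodyTailBlocks b gapLength (ell F))
  length-bodyTailBlocks = begin
    n                                          ≡⟨ sym (m∸n+n≡m (ell≤n F)) ⟩
    u + ell F                                  ≡⟨ cong (_+ ell F) u≡ ⟩
    suc (b + gapLength) + ell F                ≡⟨ cong suc (+-assoc b gapLength (ell F)) ⟩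
    1 + (b + (gapLength + ell F))              ≡⟨ cong (λ m → 1 + (b + (gapLength + m))) (sym (+-identityʳ (ell F))) ⟩
    1 + (b + (gapLength + (ell F + 0)))        ∎
    where open ≡-Reasoning

  ≡fromBlocks-bodyTail : F ≡ fromBlocks n (bodyTailBlocks b gapLength (ell F))
  ≡fromBlocks-bodyTail = ≡-fromBits pointwise
    where
    blocks = bodyTailBlocks b gapLength (ell F)
    rest₃ = (true , ell F) ∷ []
    rest₂ = (false , gapLength) ∷ rest₃
    rest₁ = (true , b) ∷ rest₂
    pointwise : ∀ {x} → x < n → bit F x ≡ blocksBit blocks x
    pointwise {x} x<n with offset 1 x
    ... | before (s≤s z≤n) = bit-outsideTail x<n (≤-<-trans z≤n (≤-trans (s≤s z≤n) b<u))
    ... | after y with offset b y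
    ...   | before y<b = trans (bit-outsideTail x<n (≤-trans (s≤s y<b) b<u))
                           (trans (<ᵇ-true y<b) (sym (trans (blocksBit-skip false 1 rest₁ y) (blocksBit-here true b rest₂ y<b))))
    ...   | after z with offset gapLength z
    ...     | before z<r = trans (bit-outsideTail x<n (subst (suc (suc (b + z)) ≤_) (sym u≡) (s≤s (+-monoʳ-< b z<r))))
                             (trans (≤ᵇ-false {suc (suc (b + z))} {suc b} (s≤s (s≤s (m≤m+n b z))))
                             (sym (trans (blocksBit-skip false 1 rest₁ (b + z)) (trans (blocksBit-skip true b rest₂ z) (blocksBit-here false gapLength rest₃ z<r)))))
    ...     | after w = trans (bit-tail F x<n (subst (_≤ suc (b + (gapLength + w))) (sym u≡) (s≤s (+-monoʳ-≤ b (m≤m+n gapLength w)))))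
                          (sym (trans (blocksBit-skip false 1 rest₁ (b + (gapLength + w)))
                               (trans (blocksBit-skip true b rest₂ (gapLength + w))
                               (trans (blocksBit-skip false gapLength rest₃ w) (blocksBit-here true (ell F) [] w<ℓ)))))
      where
      w<ℓ : w < ell F
      w<ℓ = subst (w <_) (+-identityʳ (ell F)) (+-cancelˡ-< gapLength w (ell F + 0)
              (+-cancelˡ-< b (gapLength + w) _ (≤-pred (subst (x <_) length-bodyTailBlocks x<n))))

  size-bodyTail : ∣ F ∣ ≡ b + (ell F + 0)
  size-bodyTail = trans (cong ∣_∣ ≡fromBlocks-bodyTail) (size-fromBlocks (bodyTailBlocks b gapLength (ell F)) length-bodyTailBlocks)

-- Partners

module _ {n} {F H : Subset n} (q : Fin n)
         (F∩H : F ∩ H ≡ ⁅ q ⁆) (F∪H : F ∪ H ≡ interval n 1 (suc (toℕ q))) where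

  private
    bit-∧ : ∀ x → (bit F x ∧ bit H x) ≡ (toℕ q ≡ᵇ x)
    bit-∧ x = trans (sym (bit-∩ F H x)) (trans (cong (λ A → bit A x) F∩H) (bit-⁅⁆ q x))

    bit-∨ : ∀ {x} → x < n → (bit F x ∨ bit H x) ≡ (x <ᵇ suc (toℕ q))
    bit-∨ {x} x<n = trans (sym (bit-∪ F H x)) (trans (cong (λ A → bit A x) F∪H) (bit-interval n 1 (suc (toℕ q)) x<n))

  partner-max : ∀ {x} → x < n → bit F x ≡ true → x ≤ toℕ q
  partner-max {x} x<n Fx = ≤-pred (<ᵇ⇒< x (suc (toℕ q)) (subst T (trans (cong (_∨ bit H x) (sym Fx)) (bit-∨ x<n)) _))

  partner-top : bit F (toℕ q) ≡ true
  partner-top = ∧-true (trans (bit-∧ (toℕ q)) (≡ᵇ-true (toℕ q)))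
    where
    ∧-true : ∀ {a b} → (a ∧ b) ≡ true → a ≡ true
    ∧-true {true} _ = refl

  bit-partner : ∀ {x} → x < n → bit H x ≡ (((x <ᵇ suc (toℕ q)) ∧ not (bit F x)) ∨ (toℕ q ≡ᵇ x))
  bit-partner {x} x<n = trans (complement (bit F x) (bit H x))
    (cong₂ (λ a b → (a ∧ not (bit F x)) ∨ b) (bit-∨ x<n) (bit-∧ x))
    where
    complement : ∀ f h → h ≡ (((f ∨ h) ∧ not f) ∨ (f ∧ h))
    complement true h = refl
    complement false true = refl
    complement false false = refl

  partner-pivot : ∀ {p} → p < n → bit F p ≡ true → (∀ {x} → x < n → bit F x ≡ true → x ≤ p) → toℕ q ≡ p
  partner-pivot p<n Fp below-p = ≤-antisym (below-p (toℕ<n q) partner-top) (partner-max p<n Fp)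

partner-pivot-fromBlocks : ∀ {n} {F H : Subset n} pre post (q : Fin n) →
  F ∩ H ≡ ⁅ q ⁆ → F ∪ H ≡ interval n 1 (suc (toℕ q)) →
  blocksLength pre < n → (∀ y → blocksBit post y ≡ false) →
  F ≡ fromBlocks n (pre ++ (true , 1) ∷ post) → toℕ q ≡ blocksLength pre
partner-pivot-fromBlocks {n} {F} pre post q F∩H F∪H p<n post-empty F≡ = partner-pivot q F∩H F∪H p<n F-p F-top
  where
  p = blocksLength pre
  blocksF = pre ++ (true , 1) ∷ post

  bit-F : ∀ {x} → x < n → bit F x ≡ blocksBit blocksF x
  bit-F {x} x<n = trans (cong (λ A → bit A x) F≡) (bit-fromBits n (blocksBit blocksF) x<n)

  F-p : bit F p ≡ true
  F-p = trans (bit-F p<n) (subst (λ x → blocksBit blocksF x ≡ true) (+-identityʳ p) (blocksBit-++ʳ pre _ 0))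

  F-top : ∀ {x} → x < n → bit F x ≡ true → x ≤ p
  F-top {x} x<n Fx with offset p x
  ... | before x<p = <⇒≤ x<p
  ... | after zero = ≤-reflexive (+-identityʳ p)
  ... | after (suc y) with () ← trans (sym Fx) (trans (bit-F x<n) (trans (blocksBit-++ʳ pre _ (suc y)) (post-empty y)))

-- The pivot is the last element of F, and below it the partner is the complement of F.
partner-fromBlocks : ∀ {n} {F H : Subset n} pre post →
  blocksLength pre < n → (∀ y → blocksBit post y ≡ false) →
  F ≡ fromBlocks n (pre ++ (true , 1) ∷ post) → IsPartner F H →
  H ≡ fromBlocks n (flipBlocks pre ++ (true , 1) ∷ post)
partner-fromBlocks {n} {F} {H} pre post p<n post-empty F≡ (_ , q , F∩H , F∪H) = ≡-fromBits pointwise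
  where
  p = blocksLength pre
  blocksF = pre ++ (true , 1) ∷ post
  blocksH = flipBlocks pre ++ (true , 1) ∷ post

  bit-F : ∀ {x} → x < n → bit F x ≡ blocksBit blocksF x
  bit-F {x} x<n = trans (cong (λ A → bit A x) F≡) (bit-fromBits n (blocksBit blocksF) x<n)

  q≡p : toℕ q ≡ p
  q≡p = partner-pivot-fromBlocks pre post q F∩H F∪H p<n post-empty F≡

  bit-H : ∀ {x} → x < n → bit H x ≡ (((x <ᵇ suc p) ∧ not (bit F x)) ∨ (p ≡ᵇ x))
  bit-H {x} x<n = trans (bit-partner q F∩H F∪H x<n) (cong (λ z → ((x <ᵇ suc z) ∧ not (bit F x)) ∨ (z ≡ᵇ x)) q≡p)

  p<flip : ∀ {x} → x < p → x < blocksLength (flipBlocks pre)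
  p<flip {x} = subst (x <_) (sym (blocksLength-flip pre))

  pointwise : ∀ {x} → x < n → bit H x ≡ blocksBit blocksH x
  pointwise {x} x<n with offset p x
  ... | before x<p = begin
    bit H x                                          ≡⟨ bit-H x<n ⟩
    ((x <ᵇ suc p) ∧ not (bit F x)) ∨ (p ≡ᵇ x)        ≡⟨ cong₂ (λ a c → (a ∧ not (bit F x)) ∨ c) (<ᵇ-true (m<n⇒m<1+n x<p)) (≡ᵇ-false (>⇒≢ x<p)) ⟩
    not (bit F x) ∨ false                            ≡⟨ ∨-identityʳ _ ⟩
    not (bit F x)                                    ≡⟨ cong not (trans (bit-F x<n) (blocksBit-++ˡ pre _ x<p)) ⟩
    not (blocksBit pre x)                            ≡⟨ sym (blocksBit-flip pre x<p) ⟩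
    blocksBit (flipBlocks pre) x                     ≡⟨ sym (blocksBit-++ˡ (flipBlocks pre) _ (p<flip x<p)) ⟩
    blocksBit blocksH x                              ∎
    where open ≡-Reasoning
  ... | after zero = begin
    bit H (p + 0)                                    ≡⟨ bit-H x<n ⟩
    ((p + 0 <ᵇ suc p) ∧ not (bit F (p + 0))) ∨ (p ≡ᵇ p + 0) ≡⟨ cong (((p + 0 <ᵇ suc p) ∧ not (bit F (p + 0))) ∨_) p≡ᵇp+0 ⟩
    ((p + 0 <ᵇ suc p) ∧ not (bit F (p + 0))) ∨ true  ≡⟨ ∨-zeroʳ _ ⟩
    true                                             ≡⟨ sym (blocksBit-++ʳ (flipBlocks pre) _ 0) ⟩
    blocksBit blocksH (blocksLength (flipBlocks pre) + 0) ≡⟨ cong (λ m → blocksBit blocksH (m + 0)) (blocksLength-flip pre) ⟩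
    blocksBit blocksH (p + 0)                        ∎
    where
    open ≡-Reasoning
    p≡ᵇp+0 : (p ≡ᵇ p + 0) ≡ true
    p≡ᵇp+0 = subst (λ m → (p ≡ᵇ m) ≡ true) (sym (+-identityʳ p)) (≡ᵇ-true p)
  ... | after (suc y) = begin
    bit H (p + suc y)                                ≡⟨ bit-H x<n ⟩
    ((p + suc y <ᵇ suc p) ∧ not (bit F (p + suc y))) ∨ (p ≡ᵇ p + suc y)
      ≡⟨ cong₂ (λ a c → (a ∧ not (bit F (p + suc y))) ∨ c) (<ᵇ-false p<x) (≡ᵇ-false (<⇒≢ p<x)) ⟩
    false                                            ≡⟨ sym (post-empty y) ⟩
    blocksBit post y                                 ≡⟨ sym (blocksBit-++ʳ (flipBlocks pre) _ (suc y)) ⟩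
    blocksBit blocksH (blocksLength (flipBlocks pre) + suc y) ≡⟨ cong (λ m → blocksBit blocksH (m + suc y)) (blocksLength-flip pre) ⟩
    blocksBit blocksH (p + suc y)                    ∎
    where
    open ≡-Reasoning
    p<x : p < p + suc y
    p<x = m<m+n p (s≤s z≤n)

-- 1 0^b 1^r 0^ℓ 1 : the partner of 0 1^b 0^r 1^(ℓ+1)
partnerBlocks : ℕ → ℕ → ℕ → Blocks
partnerBlocks b r ℓ = (true , 1) ∷ (false , b) ∷ (true , r) ∷ (false , ℓ) ∷ (true , 1) ∷ []

-- 1 0^b 1 0^r 1^e : the partner 1 0^b 1 0^(r+e) of 0 1^(b+1) 0^(r+e), completed by the last e elements
noTailPartnerBlocks : ℕ → ℕ → ℕ → Blocks
noTailPartnerBlocks b r e = (true , 1) ∷ (false , b) ∷ (true , 1) ∷ (false , r) ∷ (true , e) ∷ []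

partner-bodyTail : ∀ {n} {X H : Subset n} b r ℓ → n ≡ blocksLength (bodyTailBlocks b r (suc ℓ)) →
  X ≡ fromBlocks n (bodyTailBlocks b r (suc ℓ)) → IsPartner X H → H ≡ fromBlocks n (partnerBlocks b r ℓ)
partner-bodyTail {n} b r ℓ n≡ X≡ = partner-fromBlocks pre [] p<n (λ _ → refl)
  (trans X≡ (fromBlocks-cong n (bodyTailBlocks b r (suc ℓ)) (pre ++ (true , 1) ∷ [])
                              (blocksBit-++-cong pre₀ ((true , suc ℓ) ∷ []) ((true , ℓ) ∷ (true , 1) ∷ []) (blocksBit-splitRun true ℓ []))))
  where
  pre₀ = (false , 1) ∷ (true , b) ∷ (false , r) ∷ []
  pre = pre₀ ++ (true , ℓ) ∷ []
  p<n : blocksLength pre < n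
  p<n = subst (blocksLength pre <_) (sym n≡) (s≤s (+-monoʳ-< b (+-monoʳ-< r (s≤s ≤-refl))))

partner-bodyNoTail : ∀ {n} {X H : Subset n} b r → n ≡ blocksLength (bodyTailBlocks (suc b) r 0) →
  X ≡ fromBlocks n (bodyTailBlocks (suc b) r 0) → IsPartner X H → H ≡ fromBlocks n (noTailPartnerBlocks b r 0)
partner-bodyNoTail {n} b r n≡ X≡ = partner-fromBlocks pre post p<n (blocksBit-noTail r)
  (trans X≡ (fromBlocks-cong n (bodyTailBlocks (suc b) r 0) (pre ++ (true , 1) ∷ post)
                              (blocksBit-++-cong ((false , 1) ∷ []) ((true , suc b) ∷ post) ((true , b) ∷ (true , 1) ∷ post) (blocksBit-splitRun true b post))))
  where
  pre = (false , 1) ∷ (true , b) ∷ []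
  post = (false , r) ∷ (true , 0) ∷ []
  p<n : blocksLength pre < n
  p<n = subst (blocksLength pre <_) (sym n≡) (s≤s (s≤s (+-monoʳ-≤ b z≤n)))

fromBlocks-∪-finalInterval : ∀ {n} pre r e → n ≡ blocksLength pre + (r + e) →
  fromBlocks n (pre ++ (false , r + e) ∷ (true , 0) ∷ []) ∪ interval n (blocksLength pre + r + 1) n
  ≡ fromBlocks n (pre ++ (false , r) ∷ (true , e) ∷ [])
fromBlocks-∪-finalInterval {n} pre r e n≡ = ≡-fromBits pointwise
  where
  P = blocksLength pre
  oldTail = (false , r + e) ∷ (true , 0) ∷ []
  newTail = (false , r) ∷ (true , e) ∷ []
  old = pre ++ oldTail
  new = pre ++ newTail
  lhs : ∀ {x} → x < n → bit (fromBlocks n old ∪ interval n (P + r + 1) n) x ≡ (blocksBit old x ∨ (P + r ≤ᵇ x))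
  lhs {x} x<n = trans (bit-∪ (fromBlocks n old) (interval n (P + r + 1) n) x) (cong₂ _∨_ (bit-fromBits n (blocksBit old) x<n) (bit-finalInterval n (P + r) x<n))
  pointwise : ∀ {x} → x < n → bit (fromBlocks n old ∪ interval n (P + r + 1) n) x ≡ blocksBit new x
  pointwise {x} x<n with offset P x
  ... | before x<P = trans (lhs x<n)
        (trans (cong₂ _∨_ (blocksBit-++ˡ pre oldTail x<P) (≤ᵇ-false (≤-trans x<P (m≤m+n P r))))
        (trans (∨-identityʳ _) (sym (blocksBit-++ˡ pre newTail x<P))))
  ... | after y with offset r y
  ...   | before y<r = trans (lhs x<n)
          (trans (cong₂ _∨_ (trans (blocksBit-++ʳ pre oldTail y) (blocksBit-here false (r + e) ((true , 0) ∷ []) (≤-trans y<r (m≤m+n r e))))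
                           (≤ᵇ-false (+-monoʳ-< P y<r)))
          (sym (trans (blocksBit-++ʳ pre newTail y) (blocksBit-here false r ((true , e) ∷ []) y<r))))
  ...   | after z = trans (lhs x<n)
          (trans (cong₂ _∨_ (trans (blocksBit-++ʳ pre oldTail (r + z)) (blocksBit-here false (r + e) ((true , 0) ∷ []) (+-monoʳ-< r z<e)))
                           (≤ᵇ-true (+-monoʳ-≤ P (m≤m+n r z))))
          (sym (trans (blocksBit-++ʳ pre newTail (r + z)) (trans (blocksBit-skip false r ((true , e) ∷ []) z) (blocksBit-here true e [] z<e)))))
    where
    z<e : z < e
    z<e = +-cancelˡ-< r z e (+-cancelˡ-< P (r + z) (r + e) (subst (P + (r + z) <_) n≡ x<n))

noTailPartner-∪-lastElements : ∀ {n} b r e → e ≤ r → n ≡ blocksLength (noTailPartnerBlocks b r 0) →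
  fromBlocks n (noTailPartnerBlocks b r 0) ∪ interval n (n ∸ (2 + e) + 2 + 1) n ≡ fromBlocks n (noTailPartnerBlocks b (r ∸ e) e)
noTailPartner-∪-lastElements {n} b r e e≤r n≡ = begin
  fromBlocks n (pre ++ (false , r) ∷ (true , 0) ∷ []) ∪ interval n (n ∸ (2 + e) + 2 + 1) n
    ≡⟨ cong₂ (λ m u → fromBlocks n (pre ++ (false , m) ∷ (true , 0) ∷ []) ∪ interval n (u + 1) n) (sym r≡) threshold ⟩
  fromBlocks n (pre ++ (false , r′ + e) ∷ (true , 0) ∷ []) ∪ interval n (blocksLength pre + r′ + 1) n
    ≡⟨ fromBlocks-∪-finalInterval pre r′ e (trans n≡₀ (lengths b r′ e)) ⟩
  fromBlocks n (noTailPartnerBlocks b r′ e) ∎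
  where
  open ≡-Reasoning
  pre = (true , 1) ∷ (false , b) ∷ (true , 1) ∷ []
  r′ = r ∸ e
  r≡ : r′ + e ≡ r
  r≡ = m∸n+n≡m e≤r
  n≡₀ : n ≡ b + r′ + (2 + e)
  n≡₀ = trans n≡ (trans (cong (λ m → 1 + (b + (1 + (m + (0 + 0))))) (sym r≡)) (lengths₀ b r′ e))
    where
    lengths₀ : ∀ b r e → 1 + (b + (1 + ((r + e) + (0 + 0)))) ≡ b + r + (2 + e)
    lengths₀ = solve-∀
  lengths : ∀ b r e → b + r + (2 + e) ≡ 1 + (b + (1 + 0)) + (r + e)
  lengths = solve-∀
  threshold : n ∸ (2 + e) + 2 ≡ blocksLength pre + r′
  threshold = trans (cong (λ m → m ∸ (2 + e) + 2) n≡₀) (trans (cong (_+ 2) (m+n∸n≡m (b + r′) (2 + e))) (lengths₁ b r′))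
    where
    lengths₁ : ∀ b r → b + r + 2 ≡ 1 + (b + (1 + 0)) + r
    lengths₁ = solve-∀

kPartner-noTailPartner : ∀ {n} {H T : Subset n} b r e → e ≤ r → n ≡ blocksLength (noTailPartnerBlocks b r 0) →
  H ≡ fromBlocks n (noTailPartnerBlocks b r 0) → ∣ H ∣ ≡ 2 →
  (suc (suc e) ≡ ∣ H ∣ → T ≡ H) → (∣ H ∣ < suc (suc e) → T ≡ H ∪ interval n (n ∸ suc (suc e) + ∣ H ∣ + 1) n) →
  T ≡ fromBlocks n (noTailPartnerBlocks b (r ∸ e) e)
kPartner-noTailPartner b r zero _ _ H≡ ∣H∣≡2 equal _ = trans (equal (sym ∣H∣≡2)) H≡
kPartner-noTailPartner {n} {H} b r (suc e) e≤r n≡ H≡ ∣H∣≡2 _ shorter =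
  trans (shorter (subst (_< 3 + e) (sym ∣H∣≡2) (s≤s (s≤s (s≤s z≤n)))))
        (trans (cong₂ (λ A m → A ∪ interval n (n ∸ (3 + e) + m + 1) n) H≡ ∣H∣≡2)
               (noTailPartner-∪-lastElements b r (suc e) e≤r n≡))

-- the number of (e+2)-subsets of [N+1] containing 1 whose second element lies in [2, m+1]
columnSum : ℕ → ℕ → ℕ → ℕ
columnSum zero N e = 0
columnSum (suc m) zero e = 0
columnSum (suc m) (suc N) e = N C e + columnSum m N e

columnSum-suc : ∀ m X e → columnSum (suc m) (m + suc X) e ≡ columnSum m (m + suc X) e + X C e
columnSum-suc zero X e = +-comm (X C e) 0
columnSum-suc (suc m) X e = trans (cong ((m + suc X) C e +_) (columnSum-suc m X e))
  (sym (+-assoc ((m + suc X) C e) (columnSum m (m + suc X) e) (X C e)))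

lexCount-trueRun : ∀ m L bs k → lexCount (m + k) (fromBlocks (m + L) ((true , m) ∷ bs)) ≡ lexCount k (fromBlocks L bs)
lexCount-trueRun zero L bs k = cong (lexCount k) (fromBlocks-empty L true bs)
lexCount-trueRun (suc m) L bs k = lexCount-trueRun m L bs k

lexCount-trueRun-short : ∀ m L bs {k} → k < m → lexCount k (fromBlocks (m + L) ((true , m) ∷ bs)) ≡ 0
lexCount-trueRun-short (suc m) L bs {zero} _ = refl
lexCount-trueRun-short (suc m) L bs {suc k} (s≤s k<m) = lexCount-trueRun-short m L bs k<m

lexCount-falseRun : ∀ m L bs e → lexCount (suc e) (fromBlocks (m + L) ((false , m) ∷ bs))
                    ≡ columnSum m (m + L) e + lexCount (suc e) (fromBlocks L bs)
lexCount-falseRun zero L bs e = cong (lexCount (suc e)) (fromBlocks-empty L false bs)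
lexCount-falseRun (suc m) L bs e = trans (cong ((m + L) C e +_) (lexCount-falseRun m L bs e))
  (sym (+-assoc ((m + L) C e) (columnSum m (m + L) e) _))

lexCount-zero-∅ : ∀ n → lexCount 0 (fromBits n (λ _ → false)) ≡ 1
lexCount-zero-∅ zero = refl
lexCount-zero-∅ (suc n) = lexCount-zero-∅ n

-- every ℓ-subset of the last r + ℓ positions precedes their final ℓ positions
lexCount-lastSet : ∀ r ℓ → lexCount ℓ (fromBlocks (r + (ℓ + 0)) ((false , r) ∷ (true , ℓ) ∷ [])) ≡ (r + ℓ) C ℓ
lexCount-lastSet zero ℓ = begin
  lexCount ℓ (fromBlocks (ℓ + 0) ((false , 0) ∷ (true , ℓ) ∷ []))  ≡⟨ cong (lexCount ℓ) (fromBlocks-empty (ℓ + 0) false ((true , ℓ) ∷ [])) ⟩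
  lexCount ℓ (fromBlocks (ℓ + 0) ((true , ℓ) ∷ []))              ≡⟨ cong (λ k → lexCount k (fromBlocks (ℓ + 0) ((true , ℓ) ∷ []))) (sym (+-identityʳ ℓ)) ⟩
  lexCount (ℓ + 0) (fromBlocks (ℓ + 0) ((true , ℓ) ∷ []))        ≡⟨ lexCount-trueRun ℓ 0 [] 0 ⟩
  1                                                             ≡⟨ sym (nCn≡1 ℓ) ⟩
  ℓ C ℓ                                                         ∎
  where open ≡-Reasoning
lexCount-lastSet (suc r) zero = trans (cong (lexCount 0) (fromBits-cong (r + 0) λ {x} _ → blocksBit-noTail r x))
                                      (lexCount-zero-∅ (r + 0))
lexCount-lastSet (suc r) (suc ℓ) = begin
  (r + (suc ℓ + 0)) C ℓ + lexCount (suc ℓ) (fromBlocks (r + (suc ℓ + 0)) ((false , r) ∷ (true , suc ℓ) ∷ []))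
    ≡⟨ cong₂ _+_ (cong (λ m → (r + m) C ℓ) (+-identityʳ (suc ℓ))) (lexCount-lastSet r (suc ℓ)) ⟩
  (r + suc ℓ) C ℓ + (r + suc ℓ) C suc ℓ
    ≡⟨ nCk+nC[k+1]≡[n+1]C[k+1] (r + suc ℓ) ℓ ⟩
  suc (r + suc ℓ) C suc ℓ ∎
  where open ≡-Reasoning

lexCount-bodyTail : ∀ n b r ℓ → n ≡ blocksLength (bodyTailBlocks (suc b) r ℓ) →
  lexCount (suc b + ℓ) (fromBlocks n (bodyTailBlocks (suc b) r ℓ)) ≡ (n ∸ 1) C (b + ℓ) + (n ∸ 1 ∸ suc b) C ℓ
lexCount-bodyTail _ b r ℓ refl = cong₂ _+_ refl (begin
  lexCount (suc b + ℓ) (fromBlocks L ((false , 0) ∷ rest))  ≡⟨ cong (lexCount (suc b + ℓ)) (fromBlocks-empty L false rest) ⟩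
  lexCount (suc b + ℓ) (fromBlocks L rest)                 ≡⟨ lexCount-trueRun (suc b) (r + (ℓ + 0)) ((false , r) ∷ (true , ℓ) ∷ []) ℓ ⟩
  lexCount ℓ (fromBlocks (r + (ℓ + 0)) ((false , r) ∷ (true , ℓ) ∷ [])) ≡⟨ lexCount-lastSet r ℓ ⟩
  (r + ℓ) C ℓ                                              ≡⟨ cong (_C ℓ) (sym gap) ⟩
  (L ∸ suc b) C ℓ                                          ∎)
  where
  open ≡-Reasoning
  rest = (true , suc b) ∷ (false , r) ∷ (true , ℓ) ∷ []
  L = blocksLength rest
  gap : L ∸ suc b ≡ r + ℓ
  gap = trans (m+n∸m≡n (suc b) (r + (ℓ + 0))) (cong (r +_) (+-identityʳ ℓ))

lexCount-partnerBlocks : ∀ n b r ℓ e → n ≡ blocksLength (partnerBlocks b r ℓ) → suc e < r →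
  lexCount (suc (suc e)) (fromBlocks n (partnerBlocks b r ℓ)) ≡ columnSum b (n ∸ 1) e
lexCount-partnerBlocks _ b r ℓ e refl e<r = begin
  lexCount (suc e) (fromBlocks L ((true , 0) ∷ rest))      ≡⟨ cong (lexCount (suc e)) (fromBlocks-empty L true rest) ⟩
  lexCount (suc e) (fromBlocks L rest)                    ≡⟨ lexCount-falseRun b L′ rest′ e ⟩
  columnSum b L e + lexCount (suc e) (fromBlocks L′ rest′) ≡⟨ cong (columnSum b L e +_) (lexCount-trueRun-short r (blocksLength ((false , ℓ) ∷ (true , 1) ∷ [])) ((false , ℓ) ∷ (true , 1) ∷ []) e<r) ⟩
  columnSum b L e + 0                                     ≡⟨ +-identityʳ _ ⟩
  columnSum b L e                                         ∎
  where
  open ≡-Reasoning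
  rest′ = (true , r) ∷ (false , ℓ) ∷ (true , 1) ∷ []
  rest = (false , b) ∷ rest′
  L = blocksLength rest
  L′ = blocksLength rest′

lexCount-noTailPartnerBlocks : ∀ n b r e → n ≡ blocksLength (noTailPartnerBlocks b r e) →
  lexCount (suc (suc e)) (fromBlocks n (noTailPartnerBlocks b r e)) ≡ columnSum (suc b) (n ∸ 1) e
lexCount-noTailPartnerBlocks _ b r e refl = begin
  lexCount (suc e) (fromBlocks L ((true , 0) ∷ rest))      ≡⟨ cong (lexCount (suc e)) (fromBlocks-empty L true rest) ⟩
  lexCount (suc e) (fromBlocks L rest)                    ≡⟨ lexCount-falseRun b (suc X) ((true , 1) ∷ last) e ⟩
  columnSum b L e + lexCount (suc e) (fromBlocks (suc X) ((true , 1) ∷ last))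
    ≡⟨ cong (columnSum b L e +_) (trans (cong (lexCount e) (fromBlocks-empty X true last)) (lexCount-lastSet r e)) ⟩
  columnSum b L e + (r + e) C e                           ≡⟨ cong (λ m → columnSum b L e + m C e) (cong (r +_) (sym (+-identityʳ e))) ⟩
  columnSum b (b + suc X) e + X C e                       ≡⟨ sym (columnSum-suc b X e) ⟩
  columnSum (suc b) L e                                   ∎
  where
  open ≡-Reasoning
  last = (false , r) ∷ (true , e) ∷ []
  rest = (false , b) ∷ (true , 1) ∷ last
  L = blocksLength rest
  X = blocksLength last

cardL-body : ∀ {n} (X : Subset n) {b κ} → 1 ≤ b → b < n → ∣ X ∣ ≡ κ → body X ≡ interval n 2 (suc b) →
             cardL X κ ≡ (n ∸ 1) C (κ ∸ 1) + (n ∸ 1 ∸ b) C (κ ∸ b)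
cardL-body {n} X {suc b} {κ} 1≤b b<n |X| body≡ = begin
  cardL X κ                                                  ≡⟨ cardL≡lexCount X κ ⟩
  lexCount κ X                                               ≡⟨ cong₂ lexCount κ≡ X≡ ⟩
  lexCount (suc b + ℓ) (fromBlocks n blocks)                 ≡⟨ lexCount-bodyTail n b r ℓ n≡ ⟩
  (n ∸ 1) C (b + ℓ) + (n ∸ 1 ∸ suc b) C ℓ                    ≡⟨ cong₂ (λ i j → (n ∸ 1) C i + (n ∸ 1 ∸ suc b) C j)
                                                                   (cong (_∸ 1) (sym κ≡)) (sym (trans (cong (_∸ suc b) κ≡) (m+n∸m≡n (suc b) ℓ))) ⟩
  (n ∸ 1) C (κ ∸ 1) + (n ∸ 1 ∸ suc b) C (κ ∸ suc b)          ∎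
  where
  open ≡-Reasoning
  ℓ = ell X
  r = gapLength X 1≤b b<n body≡
  blocks = bodyTailBlocks (suc b) r ℓ
  n≡ = length-bodyTailBlocks X 1≤b b<n body≡
  X≡ = ≡fromBlocks-bodyTail X 1≤b b<n body≡
  κ≡ : κ ≡ suc b + ℓ
  κ≡ = trans (sym |X|) (trans (size-bodyTail X 1≤b b<n body≡) (cong (suc b +_) (+-identityʳ ℓ)))

cardL-kPartner-blocks : ∀ {n} {X T : Subset n} b r ℓ {k} → 1 ≤ b → 2 ≤ k → k ≤ r →
  n ≡ blocksLength (bodyTailBlocks b r ℓ) → X ≡ fromBlocks n (bodyTailBlocks b r ℓ) →
  IsKPartner k X T → cardL T k ≡ columnSum b (n ∸ 1) (k ∸ 2)
cardL-kPartner-blocks zero r ℓ () 2≤k k≤r n≡ X≡ kPartner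
cardL-kPartner-blocks b r ℓ {suc zero} 1≤b (s≤s ()) k≤r n≡ X≡ kPartner
cardL-kPartner-blocks {n} {X} {T} b r (suc ℓ) {suc (suc e)} _ _ k≤r n≡ X≡ (H , partner , _ , _ , lastBelow) = begin
  cardL T k                                       ≡⟨ cardL-lastBelow (lastBelow k<∣H∣) ⟩
  cardL H k                                       ≡⟨ cardL≡lexCount H k ⟩
  lexCount k H                                    ≡⟨ cong (lexCount k) H≡ ⟩
  lexCount k (fromBlocks n (partnerBlocks b r ℓ)) ≡⟨ lexCount-partnerBlocks n b r ℓ e nH≡ k≤r ⟩
  columnSum b (n ∸ 1) e                           ∎
  where
  open ≡-Reasoning
  k = suc (suc e)
  H≡ = partner-bodyTail b r ℓ n≡ X≡ partner
  nH≡ : n ≡ blocksLength (partnerBlocks b r ℓ)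
  nH≡ = trans n≡ (lengths b r ℓ)
    where
    lengths : ∀ b r ℓ → 1 + (b + (r + (suc ℓ + 0))) ≡ 1 + (b + (r + (ℓ + (1 + 0))))
    lengths = solve-∀
  k<∣H∣ : k < ∣ H ∣
  k<∣H∣ = subst (k <_) (sym (trans (cong ∣_∣ H≡) (size-fromBlocks (partnerBlocks b r ℓ) nH≡)))
                (s≤s (subst (k ≤_) (sym (+-comm r 1)) (m≤n⇒m≤1+n k≤r)))
cardL-kPartner-blocks {n} {X} {T} (suc b) r zero {suc (suc e)} _ _ k≤r n≡ X≡ (H , partner , equal , shorter , _) = begin
  cardL T k                                       ≡⟨ cong (λ A → cardL A k) T≡ ⟩
  cardL (fromBlocks n blocksT) k                  ≡⟨ cardL≡lexCount (fromBlocks n blocksT) k ⟩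
  lexCount k (fromBlocks n blocksT)               ≡⟨ lexCount-noTailPartnerBlocks n b (r ∸ e) e nT≡ ⟩
  columnSum (suc b) (n ∸ 1) e                     ∎
  where
  open ≡-Reasoning
  k = suc (suc e)
  blocksT = noTailPartnerBlocks b (r ∸ e) e
  e≤r : e ≤ r
  e≤r = ≤-trans (n≤1+n e) (≤-trans (n≤1+n (suc e)) k≤r)
  nH≡ : n ≡ blocksLength (noTailPartnerBlocks b r 0)
  nH≡ = trans n≡ (lengths b r)
    where
    lengths : ∀ b r → 1 + (suc b + (r + (0 + 0))) ≡ 1 + (b + (1 + (r + (0 + 0))))
    lengths = solve-∀
  nT≡ : n ≡ blocksLength blocksT
  nT≡ = trans nH≡ (cong (λ m → 1 + (b + (1 + m))) (trans (+-identityʳ r) (sym (trans (cong ((r ∸ e) +_) (+-identityʳ e)) (m∸n+n≡m e≤r)))))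
  H≡ = partner-bodyNoTail b r n≡ X≡ partner
  T≡ : T ≡ fromBlocks n blocksT
  T≡ = kPartner-noTailPartner b r e e≤r nH≡ H≡ (trans (cong ∣_∣ H≡) (size-fromBlocks (noTailPartnerBlocks b r 0) nH≡)) equal shorter

cardL-kPartner : ∀ {n} (X : Subset n) {b k} {T : Subset n} → 1 ≤ b → b < n → body X ≡ interval n 2 (suc b) →
  2 ≤ k → k + ∣ X ∣ < n → IsKPartner k X T → cardL T k ≡ columnSum b (n ∸ 1) (k ∸ 2)
cardL-kPartner {n} X {b} {k} 1≤b b<n body≡ 2≤k k+∣X∣<n =
  cardL-kPartner-blocks b r ℓ 1≤b 2≤k k≤r (length-bodyTailBlocks X 1≤b b<n body≡) (≡fromBlocks-bodyTail X 1≤b b<n body≡)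
  where
  ℓ = ell X
  r = gapLength X 1≤b b<n body≡
  k≤r : k ≤ r
  k≤r = +-cancelˡ-≤ (b + (ℓ + 0)) k r (≤-pred (subst₂ _<_ (reorder k b (ℓ + 0)) (trans (length-bodyTailBlocks X 1≤b b<n body≡) (reorder′ b r (ℓ + 0)))
          (subst (λ m → k + m < n) (size-bodyTail X 1≤b b<n body≡) k+∣X∣<n)))
    where
    reorder : ∀ k b ℓ → k + (b + ℓ) ≡ b + ℓ + k
    reorder = solve-∀
    reorder′ : ∀ b r ℓ → 1 + (b + (r + ℓ)) ≡ suc (b + ℓ + r)
    reorder′ = solve-∀

upward-induction : ∀ b (P : ℕ → Set) → (∀ {a} → b < a → P a) → (∀ {a} → a ≤ b → P (suc a) → P a) → ∀ a → P a
upward-induction b P done step a = go (suc b ∸ a) a refl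
  where
  go : ∀ d a → suc b ∸ a ≡ d → P a
  go zero a b<a = done (m∸n≡0⇒m≤n b<a)
  go (suc d) a eq with a ≤? b
  ... | no a≰b = done (≰⇒> a≰b)
  ... | yes a≤b = step a≤b (go d (suc a) (suc-injective (trans (sym (+-∸-assoc 1 a≤b)) eq)))

sumFromTo-step : ∀ {a b} f → a ≤ b → sumFromTo a b f ≡ f a + sumFromTo (suc a) b f
sumFromTo-step {a} {b} f a≤b rewrite +-∸-assoc 1 a≤b = refl

sumFromTo-empty : ∀ {a b} f → b < a → sumFromTo a b f ≡ 0
sumFromTo-empty f b<a rewrite m≤n⇒m∸n≡0 b<a = refl

sumFromTo-rel : (R : ℕ → ℕ → Set) → R 0 0 → (∀ {x y u v} → R x y → R u v → R (x + u) (y + v)) →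
  ∀ a b f g → (∀ i → a ≤ i → i ≤ b → R (f i) (g i)) → R (sumFromTo a b f) (sumFromTo a b g)
sumFromTo-rel R R0 R+ a b f g = upward-induction b P done step a
  where
  P : ℕ → Set
  P a = (∀ i → a ≤ i → i ≤ b → R (f i) (g i)) → R (sumFromTo a b f) (sumFromTo a b g)
  done : ∀ {a} → b < a → P a
  done b<a _ rewrite sumFromTo-empty f b<a | sumFromTo-empty g b<a = R0
  step : ∀ {a} → a ≤ b → P (suc a) → P a
  step a≤b ih fRg rewrite sumFromTo-step f a≤b | sumFromTo-step g a≤b =
    R+ (fRg _ ≤-refl a≤b) (ih λ i a<i i≤b → fRg i (<⇒≤ a<i) i≤b)

sumFromTo-cong : ∀ a b f g → (∀ i → a ≤ i → i ≤ b → f i ≡ g i) → sumFromTo a b f ≡ sumFromTo a b g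
sumFromTo-cong = sumFromTo-rel _≡_ refl (cong₂ _+_)

sumFromTo-+ : ∀ a b f g → sumFromTo a b (λ i → f i + g i) ≡ sumFromTo a b f + sumFromTo a b g
sumFromTo-+ a b f g = upward-induction b P done step a
  where
  P : ℕ → Set
  P a = sumFromTo a b (λ i → f i + g i) ≡ sumFromTo a b f + sumFromTo a b g
  done : ∀ {a} → b < a → P a
  done b<a rewrite sumFromTo-empty (λ i → f i + g i) b<a | sumFromTo-empty f b<a | sumFromTo-empty g b<a = refl
  step : ∀ {a} → a ≤ b → P (suc a) → P a
  step {a} a≤b ih rewrite sumFromTo-step (λ i → f i + g i) a≤b | sumFromTo-step f a≤b | sumFromTo-step g a≤b | ih =
    interchange (f a) (g a) (sumFromTo (suc a) b f) (sumFromTo (suc a) b g)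
    where
    interchange : ∀ x y u v → x + y + (u + v) ≡ x + u + (y + v)
    interchange = solve-∀

-- g(G) for a k₂-set G with body [2, b+1]
gFormula : (n t : ℕ) (k : ℕ → ℕ) → ℕ → ℕ
gFormula n t k b = ((n ∸ 1) C (k 1 ∸ 1) + (n ∸ 1 ∸ b) C (k 1 ∸ b))
                 + ((n ∸ 1) C (k 2 ∸ 1) + (n ∸ 1 ∸ b) C (k 2 ∸ b))
                 + sumFromTo 3 t (λ i → columnSum b (n ∸ 1) (k i ∸ 2))

GVal⇒≡gFormula : ∀ {n t k} (G : Subset n) {b v} → 1 ≤ b → b < n → body G ≡ interval n 2 (suc b) → ∣ G ∣ ≡ k 2 →
  (∀ i → 3 ≤ i → i ≤ t → 2 ≤ k i × k i + k 2 < n) → GVal n t k G v → v ≡ gFormula n t k b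
GVal⇒≡gFormula {n} {t} {k} G {b} 1≤b b<n body≡ ∣G∣ partnerSizes (G₁ , ∣G₁∣ , (_ , sameBody , _) , T , kPartner , v≡) =
  trans v≡ (cong₂ _+_ (cong₂ _+_ (cardL-body G₁ 1≤b b<n ∣G₁∣ (trans (sym sameBody) body≡)) (cardL-body G 1≤b b<n ∣G∣ body≡))
                      (sumFromTo-cong 3 t _ _ cardL-Tᵢ))
  where
  cardL-Tᵢ : ∀ i → 3 ≤ i → i ≤ t → cardL (T i) (k i) ≡ columnSum b (n ∸ 1) (k i ∸ 2)
  cardL-Tᵢ i 3≤i i≤t with partnerSizes i 3≤i i≤t
  ... | 2≤kᵢ , kᵢ+k₂<n = cardL-kPartner G 1≤b b<n body≡ 2≤kᵢ (subst (λ m → k i + m < n) (sym ∣G∣) kᵢ+k₂<n) (kPartner i 3≤i i≤t)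

-- Binomial identities

pascal : ∀ n k → suc n C suc k ≡ n C k + n C suc k
pascal n k = sym (nCk+nC[k+1]≡[n+1]C[k+1] n k)

C-pos : ∀ {n k} → k ≤ n → 0 < n C k
C-pos {n} {zero} _ = s≤s z≤n
C-pos {suc n} {suc k} (s≤s k≤n) = subst (0 <_) (sym (pascal n k)) (≤-trans (C-pos k≤n) (m≤m+n (n C k) (n C suc k)))

suc*C-suc : ∀ m x → suc x * (suc m C suc x) ≡ suc m * (m C x)
suc*C-suc zero zero = refl
suc*C-suc zero (suc x) rewrite k>n⇒nCk≡0 {1} {suc (suc x)} (s≤s (s≤s z≤n)) = *-zeroʳ (suc (suc x))
suc*C-suc (suc m) zero rewrite nC1≡n (suc (suc m)) = trans (+-identityʳ _) (sym (*-identityʳ (suc (suc m))))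
suc*C-suc (suc m) (suc x) = begin
  suc (suc x) * (suc (suc m) C suc (suc x))
    ≡⟨ cong (suc (suc x) *_) (pascal (suc m) (suc x)) ⟩
  suc (suc x) * (suc m C suc x + suc m C suc (suc x))
    ≡⟨ *-distribˡ-+ (suc (suc x)) (suc m C suc x) _ ⟩
  suc m C suc x + suc x * (suc m C suc x) + suc (suc x) * (suc m C suc (suc x))
    ≡⟨ cong₂ (λ u v → suc m C suc x + u + v) (suc*C-suc m x) (suc*C-suc m (suc x)) ⟩
  suc m C suc x + suc m * (m C x) + suc m * (m C suc x)
    ≡⟨ cong (λ u → u + suc m * (m C x) + suc m * (m C suc x)) (pascal m x) ⟩
  m C x + m C suc x + suc m * (m C x) + suc m * (m C suc x)
    ≡⟨ regroup (m C x) (m C suc x) m ⟩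
  suc (suc m) * (m C x + m C suc x)
    ≡⟨ cong (suc (suc m) *_) (sym (pascal m x)) ⟩
  suc (suc m) * (suc m C suc x) ∎
  where
  open ≡-Reasoning
  regroup : ∀ p q m → p + q + suc m * p + suc m * q ≡ suc (suc m) * (p + q)
  regroup = solve-∀

absorption : ∀ m x → (suc m ∸ x) * (suc m C x) ≡ suc m * (m C x)
absorption m zero = refl
absorption m (suc x) with x ≤? m
... | no x≰m = trans (cong (_* (suc m C suc x)) (m≤n⇒m∸n≡0 (<⇒≤ (≰⇒> x≰m))))
                    (sym (trans (cong (suc m *_) (k>n⇒nCk≡0 (m<n⇒m<1+n (≰⇒> x≰m)))) (*-zeroʳ (suc m))))
... | yes x≤m = +-cancelʳ-≡ (suc m * (m C x)) _ _ (begin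
  (m ∸ x) * A + suc m * (m C x)    ≡⟨ cong ((m ∸ x) * A +_) (sym (suc*C-suc m x)) ⟩
  (m ∸ x) * A + suc x * A          ≡⟨ sym (*-distribʳ-+ A (m ∸ x) (suc x)) ⟩
  ((m ∸ x) + suc x) * A            ≡⟨ cong (_* A) (trans (+-suc (m ∸ x) x) (cong suc (m∸n+n≡m x≤m))) ⟩
  suc m * A                        ≡⟨ cong (suc m *_) (pascal m x) ⟩
  suc m * (m C x + m C suc x)      ≡⟨ trans (*-distribˡ-+ (suc m) (m C x) (m C suc x)) (+-comm (suc m * (m C x)) _) ⟩
  suc m * (m C suc x) + suc m * (m C x) ∎)
  where
  open ≡-Reasoning
  A = suc m C suc x

binomialSum-step : ∀ m c₁ c₂ a b (e : ℕ → ℕ) → c₁ < c₂ → c₂ ≤ m → (∀ i → a ≤ i → i ≤ b → e i ≤ c₁) →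
  sumFromTo a b (λ i → m C e i) ≤ m C c₁ + m C c₂ →
  sumFromTo a b (λ i → suc m C e i) < suc m C c₁ + suc m C c₂
binomialSum-step m c₁ c₂ a b e c₁<c₂ c₂≤m e≤c₁ below = *-cancelˡ-< D _ _ (begin-strict
  D * sumFromTo a b (λ i → suc m C e i)           ≤⟨ weighted ⟩
  suc m * sumFromTo a b (λ i → m C e i)           ≤⟨ *-monoʳ-≤ (suc m) below ⟩
  suc m * (m C c₁ + m C c₂)                       ≡⟨ *-distribˡ-+ (suc m) (m C c₁) (m C c₂) ⟩
  suc m * (m C c₁) + suc m * (m C c₂)             ≡⟨ sym (cong₂ _+_ (absorption m c₁) (absorption m c₂)) ⟩
  D * (suc m C c₁) + D₂ * (suc m C c₂)            <⟨ +-monoʳ-< (D * (suc m C c₁)) (*-monoˡ-< (suc m C c₂) {{>-nonZero C₂-pos}} D₂<D) ⟩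
  D * (suc m C c₁) + D * (suc m C c₂)             ≡⟨ sym (*-distribˡ-+ D (suc m C c₁) (suc m C c₂)) ⟩
  D * (suc m C c₁ + suc m C c₂)                   ∎)
  where
  open ≤-Reasoning
  D = suc m ∸ c₁
  D₂ = suc m ∸ c₂
  D₂<D : D₂ < D
  D₂<D = ∸-monoʳ-< c₁<c₂ (m≤n⇒m≤1+n c₂≤m)
  C₂-pos : 0 < suc m C c₂
  C₂-pos = C-pos (m≤n⇒m≤1+n c₂≤m)
  weighted : D * sumFromTo a b (λ i → suc m C e i) ≤ suc m * sumFromTo a b (λ i → m C e i)
  weighted = sumFromTo-rel (λ x y → D * x ≤ suc m * y) (subst (_≤ suc m * 0) (sym (*-zeroʳ D)) z≤n)
    (λ {x} {y} {u} {v} p q → subst₂ _≤_ (sym (*-distribˡ-+ D x u)) (sym (*-distribˡ-+ (suc m) y v)) (+-mono-≤ p q))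
    a b _ _ λ i a≤i i≤b → ≤-trans (*-monoˡ-≤ (suc m C e i) (∸-monoʳ-≤ (suc m) (e≤c₁ i a≤i i≤b)))
                                  (≤-reflexive (absorption m (e i)))

binomial-peel : ∀ N b κ → b < κ → κ < N →
  (N ∸ b) C (κ ∸ b) ≡ (N ∸ suc b) C (κ ∸ suc b) + (N ∸ suc b) C (N ∸ suc κ)
binomial-peel N b κ b<κ κ<N = begin
  (N ∸ b) C (κ ∸ b)              ≡⟨ cong₂ _C_ (+-∸-assoc 1 (<-trans b<κ κ<N)) (+-∸-assoc 1 b<κ) ⟩
  suc M C suc j                  ≡⟨ pascal M j ⟩
  M C j + M C suc j              ≡⟨ cong (M C j +_) (nCk≡nC[n∸k] (∸-monoˡ-< κ<N b<κ)) ⟩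
  M C j + M C (M ∸ suc j)        ≡⟨ cong (λ i → M C j + M C i) (trans (∸-+-assoc N (suc b) (suc j)) (cong (N ∸_) b+j)) ⟩
  M C j + M C (N ∸ suc κ)        ∎
  where
  open ≡-Reasoning
  M = N ∸ suc b
  j = κ ∸ suc b
  b+j : suc b + suc j ≡ suc κ
  b+j = cong suc (trans (+-suc b j) (m+[n∸m]≡n b<κ))

-- g(b) - g(b+1) = C(M,c₁) + C(M,c₂) - Σᵢ C(M,eᵢ), with both sides moved so that no subtraction occurs
gFormula-suc : ∀ n t k b → b < k 2 → k 2 < k 1 → k 1 < n ∸ 1 →
  let M = n ∸ 1 ∸ suc b in
  gFormula n t k b + sumFromTo 3 t (λ i → M C (k i ∸ 2))
  ≡ gFormula n t k (suc b) + (M C (n ∸ 1 ∸ suc (k 1)) + M C (n ∸ 1 ∸ suc (k 2)))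
gFormula-suc n t k b b<k₂ k₂<k₁ k₁<N = begin
  (A₁ + P₁ b) + (A₂ + P₂ b) + S b +  σ
    ≡⟨ cong₂ (λ u v → (A₁ + u) + (A₂ + v) + S b + σ) (binomial-peel N b (k 1) b<k₁ k₁<N) (binomial-peel N b (k 2) b<k₂ k₂<N) ⟩
  (A₁ + (P₁ (suc b) + M C c₁)) + (A₂ + (P₂ (suc b) + M C c₂)) + S b +  σ
    ≡⟨ regroup A₁ (P₁ (suc b)) (M C c₁) A₂ (P₂ (suc b)) (M C c₂) (S b) σ ⟩
  (A₁ + P₁ (suc b)) + (A₂ + P₂ (suc b)) + (S b + σ) + (M C c₁ + M C c₂)
    ≡⟨ cong (λ s → (A₁ + P₁ (suc b)) + (A₂ + P₂ (suc b)) + s + (M C c₁ + M C c₂)) (sym S-suc) ⟩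
  (A₁ + P₁ (suc b)) + (A₂ + P₂ (suc b)) + S (suc b) + (M C c₁ + M C c₂) ∎
  where
  open ≡-Reasoning
  N = n ∸ 1
  M = N ∸ suc b
  A₁ = N C (k 1 ∸ 1)
  A₂ = N C (k 2 ∸ 1)
  P₁ P₂ S : ℕ → ℕ
  P₁ b = (N ∸ b) C (k 1 ∸ b)
  P₂ b = (N ∸ b) C (k 2 ∸ b)
  S b = sumFromTo 3 t (λ i → columnSum b N (k i ∸ 2))
  σ = sumFromTo 3 t (λ i → M C (k i ∸ 2))
  c₁ = N ∸ suc (k 1)
  c₂ = N ∸ suc (k 2)
  k₂<N = <-trans k₂<k₁ k₁<N
  b<k₁ = <-trans b<k₂ k₂<k₁
  N≡ : N ≡ b + suc M
  N≡ = sym (trans (+-suc b M) (m+[n∸m]≡n (<-trans b<k₁ k₁<N)))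
  S-suc : S (suc b) ≡ S b +  σ
  S-suc = trans (sumFromTo-cong 3 t _ _ λ i _ _ → trans (cong (λ N′ → columnSum (suc b) N′ (k i ∸ 2)) N≡)
                  (trans (columnSum-suc b M (k i ∸ 2)) (cong (λ N′ → columnSum b N′ (k i ∸ 2) + M C (k i ∸ 2)) (sym N≡))))
                (sumFromTo-+ 3 t _ _)
  regroup : ∀ a₁ p₁ x₁ a₂ p₂ x₂ s σ → (a₁ + (p₁ + x₁)) + (a₂ + (p₂ + x₂)) + s + σ ≡ (a₁ + p₁) + (a₂ + p₂) + (s + σ) + (x₁ + x₂)
  regroup = solve-∀

m+n≤o⇒m∸2≤o∸1∸[1+n] : ∀ {m n o} → 2 ≤ m → m + n ≤ o → m ∸ 2 ≤ o ∸ 1 ∸ suc n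
m+n≤o⇒m∸2≤o∸1∸[1+n] {suc zero} (s≤s ()) _
m+n≤o⇒m∸2≤o∸1∸[1+n] {suc (suc m)} {n} {suc o} _ (s≤s m+n≤o) = m+n≤o⇒m≤o∸n m (subst (_≤ o) (sym (+-suc m n)) m+n≤o)

gFormula-≤⇒< : ∀ n t k p → suc (suc p) ≤ k 2 → k 2 < k 1 → k 1 < n ∸ 1 →
  (∀ i → 3 ≤ i → i ≤ t → 2 ≤ k i × k i + k 1 ≤ n) →
  gFormula n t k (suc (suc p)) ≤ gFormula n t k (suc p) → gFormula n t k (suc p) < gFormula n t k p
gFormula-≤⇒< n t k p p+2≤k₂ k₂<k₁ k₁<N sizes gF≤gG =
  +-cancelʳ-< (φ (suc M)) gG gH (subst (_< gH + φ (suc M)) stepH (+-monoʳ-< gH ψ<φ))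
  where
  N = n ∸ 1
  M = N ∸ suc (suc p)
  gF = gFormula n t k (suc (suc p))
  gG = gFormula n t k (suc p)
  gH = gFormula n t k p
  c₁ = N ∸ suc (k 1)
  c₂ = N ∸ suc (k 2)
  φ ψ : ℕ → ℕ
  φ m = m C c₁ + m C c₂
  ψ m = sumFromTo 3 t (λ i → m C (k i ∸ 2))
  M≡ : N ∸ suc p ≡ suc M
  M≡ = +-∸-assoc 1 (≤-trans p+2≤k₂ (<⇒≤ (<-trans k₂<k₁ k₁<N)))
  stepG : gG + ψ M ≡ gF + φ M
  stepG = gFormula-suc n t k (suc p) p+2≤k₂ k₂<k₁ k₁<N
  stepH : gH + ψ (suc M) ≡ gG + φ (suc M)
  stepH = subst (λ m → gH + ψ m ≡ gG + φ m) M≡ (gFormula-suc n t k p (≤-trans (n≤1+n (suc p)) p+2≤k₂) k₂<k₁ k₁<N)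
  ψ≤φ : ψ M ≤ φ M
  ψ≤φ = +-cancelˡ-≤ gG (ψ M) (φ M) (subst (_≤ gG + φ M) (sym stepG) (+-monoˡ-≤ (φ M) gF≤gG))
  ψ<φ : ψ (suc M) < φ (suc M)
  ψ<φ = binomialSum-step M c₁ c₂ 3 t (λ i → k i ∸ 2) (∸-monoʳ-< (s≤s k₂<k₁) k₁<N) (∸-monoʳ-≤ N (m≤n⇒m≤1+n p+2≤k₂))
          (λ i 3≤i i≤t → m+n≤o⇒m∸2≤o∸1∸[1+n] (proj₁ (sizes i 3≤i i≤t)) (proj₂ (sizes i 3≤i i≤t))) ψ≤φ

antitone : ∀ (k : ℕ → ℕ) {t} → (∀ i → 2 ≤ i → i < t → k (suc i) ≤ k i) →
           ∀ {i j} → 2 ≤ i → i ≤ j → j ≤ t → k j ≤ k i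
antitone k {t} step {i} 2≤i i≤j = go (≤⇒≤′ i≤j)
  where
  go : ∀ {j} → i ≤′ j → j ≤ t → k j ≤ k i
  go ≤′-refl _ = ≤-refl
  go (≤′-step {j} i≤′j) j<t = ≤-trans (step j (≤-trans 2≤i (≤′⇒≤ i≤′j)) j<t) (go i≤′j (<⇒≤ j<t))

kᵢ-bounds : ∀ {n t} (k : ℕ → ℕ) → (∀ i → 2 ≤ i → i < t → k (suc i) ≤ k i) → 2 ≤ k t → k 1 + k 3 ≤ n →
            ∀ i → 3 ≤ i → i ≤ t → 2 ≤ k i × k i + k 1 ≤ n
kᵢ-bounds k k-step 2≤kₜ k₁+k₃≤n i 3≤i i≤t =
  ≤-trans 2≤kₜ (antitone k k-step (≤-trans (n≤1+n 2) 3≤i) i≤t ≤-refl) ,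
  ≤-trans (subst (k i + k 1 ≤_) (+-comm (k 3) (k 1)) (+-monoˡ-≤ (k 1) (antitone k k-step (s≤s (s≤s z≤n)) 3≤i i≤t))) k₁+k₃≤n

InF23⇒≡gFormula : ∀ {n t k} {X : Subset n} {b g} → 1 ≤ b → b ≤ k 2 → k 2 < k 1 → k 1 + 2 ≤ n →
  (∀ i → 3 ≤ i → i ≤ t → 2 ≤ k i × k i + k 1 ≤ n) →
  InF23 n t k X → body X ≡ interval n 2 (suc b) → GVal n t k X g → g ≡ gFormula n t k b
InF23⇒≡gFormula {n} {t} {k} {X} 1≤b b≤k₂ k₂<k₁ k₁+2≤n bounds ((∣X∣ , _) , _) body≡ =
  GVal⇒≡gFormula X 1≤b b<n body≡ ∣X∣ partnerSizes
  where
  b<n = ≤-<-trans b≤k₂ (<-trans k₂<k₁ (<-≤-trans (m<m+n (k 1) (s≤s z≤n)) k₁+2≤n))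
  partnerSizes : ∀ i → 3 ≤ i → i ≤ t → 2 ≤ k i × k i + k 2 < n
  partnerSizes i 3≤i i≤t with bounds i 3≤i i≤t
  ... | 2≤kᵢ , kᵢ+k₁≤n = 2≤kᵢ , <-≤-trans (+-monoʳ-< (k i) k₂<k₁) kᵢ+k₁≤n

lemma3p13 : (n t : ℕ) (k : ℕ → ℕ) → 3 ≤ t → k 1 > k 2
    → (∀ i → 2 ≤ i → i < t → k (suc i) ≤ k i) → 2 ≤ k t
    → k 1 + k 3 ≤ n → n < k 1 + k 2
    → (j : ℕ) → 4 ≤ j → j ≤ k 2 + 1
    → (F₂ G₂ H₂ : Subset n)
    → InF23 n t k F₂ → InF23 n t k G₂ → InF23 n t k H₂
    → body F₂ ≡ interval n 2 j → body G₂ ≡ interval n 2 (j ∸ 1) → body H₂ ≡ interval n 2 (j ∸ 2)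
    → (gF gG gH : ℕ) → GVal n t k F₂ gF → GVal n t k G₂ gG → GVal n t k H₂ gH
    → gF ≤ gG → gG < gH
lemma3p13 n t k 3≤t k₂<k₁ k-step 2≤kₜ k₁+k₃≤n _ (suc (suc (suc (suc q)))) (s≤s (s≤s (s≤s (s≤s z≤n)))) j≤k₂+1
          F₂ G₂ H₂ inF inG inH bodyF bodyG bodyH gF gG gH valF valG valH gF≤gG =
  subst₂ _<_ (sym (g≡ p+1≤k₂ inG bodyG valG)) (sym (g≡ p≤k₂ inH bodyH valH))
    (gFormula-≤⇒< n t k p p+2≤k₂ k₂<k₁ k₁<n∸1 bounds
      (subst₂ _≤_ (g≡ p+2≤k₂ inF bodyF valF) (g≡ p+1≤k₂ inG bodyG valG) gF≤gG))
  where
  p = suc q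
  bounds = kᵢ-bounds k k-step 2≤kₜ k₁+k₃≤n
  k₁+2≤n : k 1 + 2 ≤ n
  k₁+2≤n = ≤-trans (+-monoʳ-≤ (k 1) (proj₁ (bounds 3 ≤-refl 3≤t))) k₁+k₃≤n
  k₁<n∸1 : k 1 < n ∸ 1
  k₁<n∸1 = m+n≤o⇒m≤o∸n (suc (k 1)) (subst (_≤ n) (+-suc (k 1) 1) k₁+2≤n)
  p+2≤k₂ : suc (suc p) ≤ k 2
  p+2≤k₂ = ≤-pred (subst (suc (suc (suc p)) ≤_) (+-comm (k 2) 1) j≤k₂+1)
  p+1≤k₂ = ≤-trans (n≤1+n (suc p)) p+2≤k₂
  p≤k₂ = ≤-trans (n≤1+n p) p+1≤k₂
  g≡ : ∀ {X : Subset n} {b g} → suc b ≤ k 2 → InF23 n t k X → body X ≡ interval n 2 (suc (suc b)) →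
       GVal n t k X g → g ≡ gFormula n t k (suc b)
  g≡ b≤k₂ = InF23⇒≡gFormula (s≤s z≤n) b≤k₂ k₂<k₁ k₁+2≤n bounds
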